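{- Let $n\ge7$. If $n\equiv0$ or $2\pmod3$, there is a collection of $\frac13\binom{n-5}{2}$ rowmotion orbits on $\mathcal{IC}([2]\times[n])$, each of size $n+5$, that together include all ICS of the form $[x-1,y,n-x-y+1:\varnothing]$ with $x,y\ge4$ (and $x+y\le n+1$). If $n\equiv1\pmod3$, there is a collection consisting of one orbit of size $\frac{n+5}{3}$ and $\frac{(n-4)(n-7)}{6}$ orbits of size $n+5$ that together include all such ICS.
   Context: $[2]\times[n]=\{(i,j): i\in\{1,2\},1\le j\le n\}$ with the componentwise order. An interval-closed set (ICS) is a subset $I$ with $x,y\in I$, $x\le z\le y\Rightarrow z\in I$. The toggle $t_x$ sends $I$ to $I\triangle\{x\}$ if this is an ICS, and to $I$ otherwise; rowmotion is $\mathrm{Row}=t_{x_1}\circ\cdots\circ t_{x_N}$ for any linear extension $x_1,\dots,x_N$ (toggles applied top to bottom). For nonnegative $b+i+a=n$, $[b,i,a:\varnothing]$ denotes $\{(1,j): b<j\le b+i\}$. -}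

module Defs where

open import Data.Nat using (ℕ; zero; suc; _+_; _*_; _∸_; _≤_; _<_)
import Data.Nat
open import Data.Nat.Combinatorics using (_C_)
open import Data.Bool using (Bool; true; false; not; _∧_; _∨_; if_then_else_)
open import Data.Fin using (Fin; toℕ) renaming (zero to fzero; suc to fsuc)
import Data.Fin as F
open import Data.List using (List; []; _∷_; concatMap; map; allFin)
open import Data.Vec using (Vec; lookup; updateAt; replicate; tabulate)
open import Data.Product using (_×_; _,_; Σ; ∃)
open import Relation.Nullary using (¬_; does)
open import Relation.Binary.PropositionalEquality using (_≡_; _≢_)

-- Elements of [2]×[n]: (i , j) with i : Fin 2 (0 ↦ row 1, 1 ↦ row 2),
-- j : Fin n (index j ↦ column j+1).
Elt : ℕ → Set
Elt n = Fin 2 × Fin n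

elems : (n : ℕ) → List (Elt n)
elems n = concatMap (λ i → map (λ j → (i , j)) (allFin n)) (allFin 2)

_≼_ : ∀ {n} → Elt n → Elt n → Bool
(i , j) ≼ (i' , j') = does (i F.≤? i') ∧ does (j F.≤? j')

Sub : ℕ → Set
Sub n = Vec (Vec Bool n) 2

_∈?_ : ∀ {n} → Elt n → Sub n → Bool
(i , j) ∈? S = lookup (lookup S i) j

allL : ∀ {A : Set} → (A → Bool) → List A → Bool
allL p []       = true
allL p (x ∷ xs) = p x ∧ allL p xs

isICS : ∀ {n} → Sub n → Bool
isICS {n} I =
  allL (λ x → allL (λ y → allL (λ z →
    not ((x ∈? I) ∧ (y ∈? I) ∧ (x ≼ z) ∧ (z ≼ y)) ∨ (z ∈? I))
    (elems n)) (elems n)) (elems n)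

IsICS : ∀ {n} → Sub n → Set
IsICS I = isICS I ≡ true

flipAt : ∀ {n} → Elt n → Sub n → Sub n
flipAt (i , j) S = updateAt S i (λ row → updateAt row j not)

toggle : ∀ {n} → Elt n → Sub n → Sub n
toggle x I = if isICS (flipAt x I) then flipAt x I else I

-- A fixed linear extension x_1, ..., x_N of [2]×[n]:
-- (1,1),(2,1),(1,2),(2,2),...,(1,n),(2,n).
linExt : (n : ℕ) → List (Elt n)
linExt n = concatMap (λ j → (fzero , j) ∷ (fsuc fzero , j) ∷ []) (allFin n)

-- Row = t_{x_1} ∘ ... ∘ t_{x_N}  (t_{x_N} is applied first).
foldToggles : ∀ {n} → List (Elt n) → Sub n → Sub n
foldToggles []       I = I
foldToggles (x ∷ xs) I = toggle x (foldToggles xs I)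

Row : ∀ {n} → Sub n → Sub n
Row {n} = foldToggles (linExt n)

Row^ : ∀ {n} → ℕ → Sub n → Sub n
Row^ zero    I = I
Row^ (suc k) I = Row (Row^ k I)

InOrbit : ∀ {n} → Sub n → Sub n → Set
InOrbit I J = ∃ λ k → Row^ k I ≡ J

OrbitSize : ∀ {n} → Sub n → ℕ → Set
OrbitSize I s = (0 < s) × (Row^ s I ≡ I) × (∀ k → 0 < k → k < s → Row^ k I ≢ I)

-- The ICS [b,i,a:∅] = {(1,j) : b < j ≤ b+i}  (1-indexed j), row 2 empty.
bia∅ : (n b i : ℕ) → Sub n
bia∅ n b i = tabulate (λ r → tabulate (λ j → rowBit r j))
  where
  rowBit : Fin 2 → Fin n → Bool
  rowBit fzero j = does (b Data.Nat.≤? toℕ j) ∧ does (suc (toℕ j) Data.Nat.≤? (b + i))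
  rowBit (fsuc _) j = false

-- A collection of m rowmotion orbits, given by representatives
-- reps, all ICS and lying in pairwise distinct orbits.
DistinctOrbits : ∀ {n m} → Vec (Sub n) m → Set
DistinctOrbits {n} {m} reps =
  (∀ r → IsICS (lookup reps r)) ×
  (∀ r r' → r ≢ r' → ¬ InOrbit (lookup reps r) (lookup reps r'))

CoversTargets : ∀ {n m} → Vec (Sub n) m → Set
CoversTargets {n} {m} reps =
  ∀ x y → 4 ≤ x → 4 ≤ y → x + y ≤ n + 1 →
    Σ (Fin m) λ r → InOrbit (lookup reps r) (bia∅ n (x ∸ 1) y)

{-# OPTIONS --safe #-}
module Submission where

-- Write an ICS of [2]×[n] with two interval rows as ⟦ a , b ∣ c , d ⟧: row 1 is [a , b)
-- and row 2 is [c , d) (0-based columns). A triple (p , q , r) with p + q + r = n - 7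
-- stands for [3 + p , 4 + q , r : ∅], and these are exactly the ICS of the theorem.
-- Rowmotion is a sweep of toggles over the columns from right to left, and on sets of
-- this shape each sweep changes only a few columns, so it can be computed in closed
-- form. Following the orbit, 4 + r steps lead from (p , q , r) to (r , p , q), and the
-- sets in between all have a nonempty second row. Hence the orbit of (p , q , r) meets
-- the targets exactly in its three rotations, and has (4 + p) + (4 + q) + (4 + r) = n + 5
-- elements unless p = q = r, when it has (n + 5) / 3; that case occurs exactly for
-- n ≡ 1 (mod 3). One representative per rotation class gives the collection; the
-- representatives with a zero entry number n - 7, and the others arise from those for
-- n - 3 by adding 1 to each entry, which yields the binomial counts.

open import Defs
open import Data.Bool using (Bool; true; false; not; _∧_; _∨_; if_then_else_)
open import Data.Bool.Properties using (¬-not)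
open import Data.Empty using (⊥)
open import Data.Fin using (Fin; toℕ; fromℕ<) renaming (zero to fzero; suc to fsuc)
import Data.Fin.Properties as Fin
open import Data.List using (List; []; _∷_; _++_; map; concatMap; allFin; foldr; length)
import Data.List as List
open import Data.List.Properties using (length-++; length-map)
open import Data.List.Membership.Propositional using (_∈_)
open import Data.List.Membership.Propositional.Properties
  using (∈-concatMap⁺; ∈-map⁺; ∈-map⁻; ∈-allFin; ∈-++⁺ˡ; ∈-++⁺ʳ; ∈-++⁻; ∈-lookup)
import Data.List.Relation.Unary.All as All
open import Data.List.Relation.Unary.Any using (here; there; index)
import Data.List.Relation.Unary.Any as Any
open import Data.List.Relation.Unary.Any.Properties using (lookup-index)
open import Data.List.Relation.Unary.AllPairs using ([]; _∷_)
open import Data.List.Relation.Unary.Unique.Propositional using (Unique)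
import Data.List.Relation.Unary.Unique.Propositional.Properties as Unique
open import Data.Nat using (ℕ; zero; suc; _+_; _*_; _∸_; _%_; _/_; _≤_; _<_; z≤n; s≤s; z<s; _≤?_; _<?_; _≟_; NonZero)
open import Data.Nat.Properties
open import Data.Nat.Combinatorics using (_C_; nCk+nC[k+1]≡[n+1]C[k+1]; nC1≡n)
open import Data.Nat.DivMod using (m≡m%n+[m/n]*n; m%n<n; m*n%n≡0)
open import Data.Nat.Divisibility using (divides; m%n≡0⇒n∣m)
open import Data.Nat.Solver using (module +-*-Solver)
open import Data.Product using (_×_; _,_; Σ; ∃; proj₁; proj₂)
open import Data.Sum using (_⊎_; inj₁; inj₂)
open import Data.Vec using (Vec; []; _∷_; lookup; tabulate; updateAt)
import Data.Vec.Properties as Vec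
open import Function using (_∘_; _⇔_; mk⇔; Equivalence)
open import Relation.Binary using (tri<; tri≈; tri>)
open import Relation.Binary.PropositionalEquality
open import Relation.Nullary using (¬_; Dec; yes; no; does; contradiction)
open import Relation.Nullary.Decidable using (dec-true; dec-false)

open +-*-Solver using (solve; _:+_; _:*_; _:=_; con)

-- Two-row subsets and intervals

does⇒ : ∀ {A : Set} (a? : Dec A) → does a? ≡ true → A
does⇒ (yes a) _ = a

∧-elimˡ : ∀ a {b} → a ∧ b ≡ true → a ≡ true
∧-elimˡ true _ = refl

∧-elimʳ : ∀ a {b} → a ∧ b ≡ true → b ≡ true
∧-elimʳ true b≡true = b≡true

rowOf : Fin 2 → (ℕ → Bool) → (ℕ → Bool) → ℕ → Bool
rowOf fzero    r₁ r₂ = r₁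
rowOf (fsuc _) r₁ r₂ = r₂

-- Abstract, so that unification treats interval, invertAt and fromRows as rigid.
abstract
  -- The half-open interval [a , b) of 0-based column indices.
  interval : ℕ → ℕ → ℕ → Bool
  interval a b k = does (a ≤? k) ∧ does (suc k ≤? b)

  interval-∈ : ∀ {a b k} → a ≤ k → k < b → interval a b k ≡ true
  interval-∈ {a} {b} {k} a≤k k<b rewrite dec-true (a ≤? k) a≤k | dec-true (suc k ≤? b) k<b = refl

  interval-< : ∀ {a b k} → k < a → interval a b k ≡ false
  interval-< {a} {b} {k} k<a rewrite dec-false (a ≤? k) (<⇒≱ k<a) = refl

  interval-≥ : ∀ {a b k} → b ≤ k → interval a b k ≡ false
  interval-≥ {a} {b} {k} b≤k with does (a ≤? k)
  ... | false = refl
  ... | true rewrite dec-false (suc k ≤? b) (≤⇒≯ b≤k) = refl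

  interval-bounds : ∀ {a b k} → interval a b k ≡ true → a ≤ k × k < b
  interval-bounds {a} {b} {k} k∈ = does⇒ (a ≤? k) (∧-elimˡ _ k∈) , does⇒ (suc k ≤? b) (∧-elimʳ (does (a ≤? k)) k∈)

  interval-cong-end : ∀ {a b b′ i} → i < b → i < b′ → interval a b i ≡ interval a b′ i
  interval-cong-end {a} {b} {b′} {i} i<b i<b′ rewrite dec-true (suc i ≤? b) i<b | dec-true (suc i ≤? b′) i<b′ = refl

  interval-cong-start : ∀ {a a′ b i} → a ≤ i → a′ ≤ i → interval a b i ≡ interval a′ b i
  interval-cong-start {a} {a′} {b} {i} a≤i a′≤i rewrite dec-true (a ≤? i) a≤i | dec-true (a′ ≤? i) a′≤i = refl

  invertAt : ℕ → (ℕ → Bool) → ℕ → Bool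
  invertAt k r i = if does (i ≟ k) then not (r i) else r i

  invertAt-here : ∀ k r → invertAt k r k ≡ not (r k)
  invertAt-here k r rewrite dec-true (k ≟ k) refl = refl

  invertAt-on : ∀ {k r} → r k ≡ false → invertAt k r k ≡ true
  invertAt-on {k} {r} rk = trans (invertAt-here k r) (cong not rk)

  invertAt-off : ∀ {k r} → r k ≡ true → invertAt k r k ≡ false
  invertAt-off {k} {r} rk = trans (invertAt-here k r) (cong not rk)

  invertAt-there : ∀ {k r i v} → i ≢ k → r i ≡ v → invertAt k r i ≡ v
  invertAt-there {k} {r} {i} i≢k ri rewrite dec-false (i ≟ k) i≢k = ri

  -- r₁ k says whether (1 , k + 1) is in the set, r₂ k whether (2 , k + 1) is.
  fromRows : ∀ n → (ℕ → Bool) → (ℕ → Bool) → Sub n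
  fromRows n r₁ r₂ = tabulate (r₁ ∘ toℕ) ∷ tabulate (r₂ ∘ toℕ) ∷ []

  ∈?-fromRows : ∀ {n} r₁ r₂ (x : Elt n) → x ∈? fromRows n r₁ r₂ ≡ rowOf (proj₁ x) r₁ r₂ (toℕ (proj₂ x))
  ∈?-fromRows r₁ r₂ (fzero , j) = Vec.lookup∘tabulate _ j
  ∈?-fromRows r₁ r₂ (fsuc fzero , j) = Vec.lookup∘tabulate _ j

  updateAt-invertAt : ∀ {n} (r : ℕ → Bool) (j : Fin n) →
    updateAt (tabulate (r ∘ toℕ)) j not ≡ tabulate (invertAt (toℕ j) r ∘ toℕ)
  updateAt-invertAt r j = trans (sym (Vec.tabulate∘lookup _)) (Vec.tabulate-cong pointwise)
    where
    pointwise : ∀ i → lookup (updateAt (tabulate (r ∘ toℕ)) j not) i ≡ invertAt (toℕ j) r (toℕ i)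
    pointwise i with i Fin.≟ j
    ... | yes refl = trans (Vec.lookup∘updateAt i (tabulate (r ∘ toℕ)))
                       (trans (cong not (Vec.lookup∘tabulate _ i)) (sym (invertAt-here (toℕ i) r)))
    ... | no i≢j = trans (Vec.lookup∘updateAt′ i j i≢j (tabulate (r ∘ toℕ)))
                     (trans (Vec.lookup∘tabulate _ i) (sym (invertAt-there {r = r} (i≢j ∘ Fin.toℕ-injective) refl)))

  flipAt-fromRows₁ : ∀ {n} r₁ r₂ (j : Fin n) → flipAt (fzero , j) (fromRows n r₁ r₂) ≡ fromRows n (invertAt (toℕ j) r₁) r₂
  flipAt-fromRows₁ r₁ r₂ j = cong (λ v → v ∷ _ ∷ []) (updateAt-invertAt r₁ j)

  flipAt-fromRows₂ : ∀ {n} r₁ r₂ (j : Fin n) → flipAt (fsuc fzero , j) (fromRows n r₁ r₂) ≡ fromRows n r₁ (invertAt (toℕ j) r₂)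
  flipAt-fromRows₂ r₁ r₂ j = cong (λ v → _ ∷ v ∷ []) (updateAt-invertAt r₂ j)

  fromRows-cong : ∀ {n r₁ r₂ s₁ s₂} → r₁ ≗ s₁ → r₂ ≗ s₂ → fromRows n r₁ r₂ ≡ fromRows n s₁ s₂
  fromRows-cong r₁≗s₁ r₂≗s₂ =
    cong₂ (λ u v → u ∷ v ∷ []) (Vec.tabulate-cong (r₁≗s₁ ∘ toℕ)) (Vec.tabulate-cong (r₂≗s₂ ∘ toℕ))

  fromRows-injective : ∀ {n r₁ r₂ s₁ s₂} (i : Fin 2) → fromRows n r₁ r₂ ≡ fromRows n s₁ s₂ →
    ∀ {k} → k < n → rowOf i r₁ r₂ k ≡ rowOf i s₁ s₂ k
  fromRows-injective {n} {r₁} {r₂} {s₁} {s₂} i eq {k} k<n = begin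
    rowOf i r₁ r₂ k                  ≡⟨ cong (rowOf i r₁ r₂) (Fin.toℕ-fromℕ< k<n) ⟨
    rowOf i r₁ r₂ (toℕ j)            ≡⟨ ∈?-fromRows r₁ r₂ (i , j) ⟨
    (i , j) ∈? fromRows n r₁ r₂      ≡⟨ cong ((i , j) ∈?_) eq ⟩
    (i , j) ∈? fromRows n s₁ s₂      ≡⟨ ∈?-fromRows s₁ s₂ (i , j) ⟩
    rowOf i s₁ s₂ (toℕ j)            ≡⟨ cong (rowOf i s₁ s₂) (Fin.toℕ-fromℕ< k<n) ⟩
    rowOf i s₁ s₂ k                  ∎
    where
    open ≡-Reasoning
    j : Fin n
    j = fromℕ< k<n

  bia∅≡fromRows : ∀ n b i → bia∅ n b i ≡ fromRows n (interval b (b + i)) (interval 0 0)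
  bia∅≡fromRows n b i = refl

interval-empty : ∀ {a b} → b ≤ a → ∀ k → interval a b k ≡ false
interval-empty {a} {b} b≤a k with a ≤? k
... | yes a≤k = interval-≥ (≤-trans b≤a a≤k)
... | no a≰k = interval-< (≰⇒> a≰k)

interval-empty-≗ : ∀ {a b a′ b′} → b ≤ a → b′ ≤ a′ → interval a b ≗ interval a′ b′
interval-empty-≗ b≤a b′≤a′ i = trans (interval-empty b≤a i) (sym (interval-empty b′≤a′ i))

interval-injective : ∀ {n a b a′ b′} → a < b → a′ < b′ → b ≤ n → b′ ≤ n →
  (∀ {k} → k < n → interval a b k ≡ interval a′ b′ k) → a ≡ a′ × b ≡ b′
interval-injective {n} {a} {b} {a′} {b′} a<b a′<b′ b≤n b′≤n same = a≡a′ , b≡b′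
  where
  a≡a′ : a ≡ a′
  a≡a′ with <-cmp a a′
  ... | tri≈ _ a≡a′ _ = a≡a′
  ... | tri< a<a′ _ _ = contradiction
    (trans (sym (interval-∈ ≤-refl a<b)) (trans (same (<-≤-trans a<b b≤n)) (interval-< a<a′))) λ ()
  ... | tri> _ _ a′<a = contradiction
    (trans (sym (interval-∈ ≤-refl a′<b′)) (trans (sym (same (<-≤-trans a′<b′ b′≤n))) (interval-< a′<a))) λ ()
  b≡b′ : b ≡ b′
  b≡b′ with <-cmp b b′
  ... | tri≈ _ b≡b′ _ = b≡b′
  ... | tri< b<b′ _ _ = contradiction
    (trans (sym (interval-∈ (subst (_≤ b) a≡a′ (<⇒≤ a<b)) b<b′)) (trans (sym (same (<-≤-trans b<b′ b′≤n))) (interval-≥ ≤-refl))) λ ()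
  ... | tri> _ _ b′<b = contradiction
    (trans (sym (interval-∈ (subst (_≤ b′) (sym a≡a′) (<⇒≤ a′<b′)) b′<b)) (trans (same (<-≤-trans b′<b b≤n)) (interval-≥ ≤-refl))) λ ()

invertAt-extendʳ : ∀ {a b} → a ≤ b → ∀ i → invertAt b (interval a b) i ≡ interval a (suc b) i
invertAt-extendʳ {a} {b} a≤b i with <-cmp i b
... | tri< i<b _ _ = invertAt-there (<⇒≢ i<b) (interval-cong-end i<b (m<n⇒m<1+n i<b))
... | tri≈ _ refl _ = trans (invertAt-on (interval-≥ ≤-refl)) (sym (interval-∈ a≤b (n<1+n b)))
... | tri> _ _ b<i = invertAt-there (>⇒≢ b<i) (trans (interval-≥ (<⇒≤ b<i)) (sym (interval-≥ b<i)))

invertAt-extendˡ : ∀ {k b} → k < b → ∀ i → invertAt k (interval (suc k) b) i ≡ interval k b i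
invertAt-extendˡ {k} {b} k<b i with <-cmp i k
... | tri< i<k _ _ = invertAt-there (<⇒≢ i<k) (trans (interval-< (m<n⇒m<1+n i<k)) (sym (interval-< i<k)))
... | tri≈ _ refl _ = trans (invertAt-on (interval-< (n<1+n k))) (sym (interval-∈ ≤-refl k<b))
... | tri> _ _ k<i = invertAt-there (>⇒≢ k<i) (interval-cong-start k<i (<⇒≤ k<i))

invertAt-shrinkˡ : ∀ {a b} → a < b → ∀ i → invertAt a (interval a b) i ≡ interval (suc a) b i
invertAt-shrinkˡ {a} {b} a<b i with <-cmp i a
... | tri< i<a _ _ = invertAt-there (<⇒≢ i<a) (trans (interval-< i<a) (sym (interval-< (m<n⇒m<1+n i<a))))
... | tri≈ _ refl _ = trans (invertAt-off (interval-∈ ≤-refl a<b)) (sym (interval-< (n<1+n a)))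
... | tri> _ _ a<i = invertAt-there (>⇒≢ a<i) (interval-cong-start (<⇒≤ a<i) a<i)

invertAt-shrinkʳ : ∀ {a k} → a ≤ k → ∀ i → invertAt k (interval a (suc k)) i ≡ interval a k i
invertAt-shrinkʳ {a} {k} a≤k i with <-cmp i k
... | tri< i<k _ _ = invertAt-there (<⇒≢ i<k) (interval-cong-end (m<n⇒m<1+n i<k) i<k)
... | tri≈ _ refl _ = trans (invertAt-off (interval-∈ a≤k (n<1+n k))) (sym (interval-≥ ≤-refl))
... | tri> _ _ k<i = invertAt-there (>⇒≢ k<i) (trans (interval-≥ k<i) (sym (interval-≥ (<⇒≤ k<i))))

invertAt-empty : ∀ {a b k} → b ≤ a → ∀ i → invertAt k (interval a b) i ≡ interval k (suc k) i
invertAt-empty {a} {b} {k} b≤a i with <-cmp i k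
... | tri< i<k _ _ = invertAt-there (<⇒≢ i<k) (trans (interval-empty b≤a i) (sym (interval-< i<k)))
... | tri≈ _ refl _ = trans (invertAt-on (interval-empty b≤a i)) (sym (interval-∈ ≤-refl (n<1+n k)))
... | tri> _ _ k<i = invertAt-there (>⇒≢ k<i) (trans (interval-empty b≤a i) (sym (interval-≥ k<i)))

-- Interval-closed two-row subsets

allL-intro : ∀ {A : Set} (p : A → Bool) → (∀ x → p x ≡ true) → ∀ xs → allL p xs ≡ true
allL-intro p all-true [] = refl
allL-intro p all-true (x ∷ xs) rewrite all-true x = allL-intro p all-true xs

allL-elim : ∀ {A : Set} {p : A → Bool} {xs x} → allL p xs ≡ true → x ∈ xs → p x ≡ true
allL-elim {p = p} {x ∷ xs} all-true (here refl) = ∧-elimˡ (p x) all-true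
allL-elim {p = p} {y ∷ xs} all-true (there x∈xs) = allL-elim (∧-elimʳ (p y) all-true) x∈xs

∈-elems : ∀ {n} (x : Elt n) → x ∈ elems n
∈-elems {n} (i , j) = ∈-concatMap⁺ (λ i → map (i ,_) (allFin n)) (Any.map (λ { refl → ∈-map⁺ (i ,_) (∈-allFin j) }) (∈-allFin i))

≼-intro : ∀ {n} {i i′ : Fin 2} {j j′ : Fin n} → toℕ i ≤ toℕ i′ → toℕ j ≤ toℕ j′ → ((i , j) ≼ (i′ , j′)) ≡ true
≼-intro {i = i} {i′} {j} {j′} i≤i′ j≤j′ rewrite dec-true (i Fin.≤? i′) i≤i′ | dec-true (j Fin.≤? j′) j≤j′ = refl

≼-bounds : ∀ {n} (x y : Elt n) → (x ≼ y) ≡ true → toℕ (proj₁ x) ≤ toℕ (proj₁ y) × toℕ (proj₂ x) ≤ toℕ (proj₂ y)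
≼-bounds (i , j) (i′ , j′) x≼y =
  does⇒ (i Fin.≤? i′) (∧-elimˡ _ x≼y) , does⇒ (j Fin.≤? j′) (∧-elimʳ (does (i Fin.≤? i′)) x≼y)

Closed : ∀ {n} → Sub n → Elt n → Elt n → Elt n → Set
Closed I x y z = (x ∈? I) ≡ true → (y ∈? I) ≡ true → (x ≼ z) ≡ true → (z ≼ y) ≡ true → (z ∈? I) ≡ true

isICS-intro : ∀ {n} (I : Sub n) → (∀ x y z → Closed I x y z) → IsICS I
isICS-intro {n} I closed =
  allL-intro _ (λ x → allL-intro _ (λ y → allL-intro _ (λ z → implication (closed x y z)) (elems n)) (elems n)) (elems n)
  where
  implication : ∀ {a b c d e} → (a ≡ true → b ≡ true → c ≡ true → d ≡ true → e ≡ true) →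
    (not (a ∧ b ∧ c ∧ d) ∨ e) ≡ true
  implication {true} {true} {true} {true} h = h refl refl refl refl
  implication {true} {true} {true} {false} h = refl
  implication {true} {true} {false} h = refl
  implication {true} {false} h = refl
  implication {false} h = refl

isICS-violated : ∀ {n} (I : Sub n) {x y z} → (x ∈? I) ≡ true → (y ∈? I) ≡ true →
  (x ≼ z) ≡ true → (z ≼ y) ≡ true → (z ∈? I) ≡ false → isICS I ≡ false
isICS-violated I {x} {y} {z} x∈I y∈I x≼z z≼y z∉I = ¬-not λ ics →
  contradiction (trans (sym z∉I) (closed-at (allL-elim (allL-elim (allL-elim ics (∈-elems x)) (∈-elems y)) (∈-elems z)))) λ ()
  where
  closed-at : (not ((x ∈? I) ∧ (y ∈? I) ∧ (x ≼ z) ∧ (z ≼ y)) ∨ (z ∈? I)) ≡ true → (z ∈? I) ≡ true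
  closed-at h rewrite x∈I | y∈I | x≼z | z≼y = h

Convex : (ℕ → Bool) → Set
Convex r = ∀ {i j k} → r i ≡ true → r k ≡ true → i ≤ j → j ≤ k → r j ≡ true

Linked : (ℕ → Bool) → (ℕ → Bool) → Set
Linked r₁ r₂ = ∀ {i j k} → r₁ i ≡ true → r₂ k ≡ true → i ≤ j → j ≤ k → r₁ j ≡ true × r₂ j ≡ true

fromRows-isICS : ∀ {n r₁ r₂} → Convex r₁ → Convex r₂ → Linked r₁ r₂ → IsICS (fromRows n r₁ r₂)
fromRows-isICS {n} {r₁} {r₂} convex₁ convex₂ linked = isICS-intro (fromRows n r₁ r₂) closed
  where
  member : ∀ x → (x ∈? fromRows n r₁ r₂) ≡ true → rowOf (proj₁ x) r₁ r₂ (toℕ (proj₂ x)) ≡ true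
  member x x∈ = trans (sym (∈?-fromRows r₁ r₂ x)) x∈

  rows : ∀ {a b c} (u v w : Fin 2) → rowOf u r₁ r₂ a ≡ true → rowOf v r₁ r₂ c ≡ true →
    toℕ u ≤ toℕ w → toℕ w ≤ toℕ v → a ≤ b → b ≤ c → rowOf w r₁ r₂ b ≡ true
  rows fzero        fzero        fzero        a∈ c∈ _ _ a≤b b≤c = convex₁ a∈ c∈ a≤b b≤c
  rows fzero        (fsuc fzero) fzero        a∈ c∈ _ _ a≤b b≤c = proj₁ (linked a∈ c∈ a≤b b≤c)
  rows fzero        (fsuc fzero) (fsuc fzero) a∈ c∈ _ _ a≤b b≤c = proj₂ (linked a∈ c∈ a≤b b≤c)
  rows (fsuc fzero) (fsuc fzero) (fsuc fzero) a∈ c∈ _ _ a≤b b≤c = convex₂ a∈ c∈ a≤b b≤c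
  rows fzero        fzero        (fsuc fzero) _ _ _ ()
  rows (fsuc fzero) _            fzero        _ _ () _
  rows (fsuc fzero) fzero        (fsuc fzero) _ _ _ ()

  closed : ∀ x y z → Closed (fromRows n r₁ r₂) x y z
  closed x@(u , _) y@(v , _) z@(w , _) x∈ y∈ x≼z z≼y =
    trans (∈?-fromRows r₁ r₂ z)
      (rows u v w (member x x∈) (member y y∈) (proj₁ (≼-bounds x z x≼z)) (proj₁ (≼-bounds z y z≼y))
                  (proj₂ (≼-bounds x z x≼z)) (proj₂ (≼-bounds z y z≼y)))

interval-convex : ∀ a b → Convex (interval a b)
interval-convex a b i∈ k∈ i≤j j≤k =
  interval-∈ (≤-trans (proj₁ (interval-bounds i∈)) i≤j) (≤-<-trans j≤k (proj₂ (interval-bounds k∈)))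

data Compatible (a b c d : ℕ) : Set where
  row₁-empty : b ≤ a → Compatible a b c d
  row₂-empty : d ≤ c → Compatible a b c d
  row₂-left  : d ≤ a → Compatible a b c d
  shifted    : c ≤ a → d ≤ b → Compatible a b c d

interval-linked : ∀ {a b c d} → Compatible a b c d → Linked (interval a b) (interval c d)
interval-linked (row₁-empty b≤a) i∈ _ _ _ =
  contradiction (≤-<-trans (proj₁ (interval-bounds i∈)) (proj₂ (interval-bounds i∈))) (≤⇒≯ b≤a)
interval-linked (row₂-empty d≤c) _ k∈ _ _ =
  contradiction (≤-<-trans (proj₁ (interval-bounds k∈)) (proj₂ (interval-bounds k∈))) (≤⇒≯ d≤c)
interval-linked (row₂-left d≤a) i∈ k∈ i≤j j≤k =
  contradiction (≤-<-trans (≤-trans (proj₁ (interval-bounds i∈)) (≤-trans i≤j j≤k)) (proj₂ (interval-bounds k∈))) (≤⇒≯ d≤a)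
interval-linked {a} {d = d} (shifted c≤a d≤b) {j = j} i∈ k∈ i≤j j≤k =
  interval-∈ a≤j (<-≤-trans j<d d≤b) , interval-∈ (≤-trans c≤a a≤j) j<d
  where
  a≤j : a ≤ j
  a≤j = ≤-trans (proj₁ (interval-bounds i∈)) i≤j
  j<d : j < d
  j<d = ≤-<-trans j≤k (proj₂ (interval-bounds k∈))

intervals-isICS : ∀ {n a b c d} → Compatible a b c d → IsICS (fromRows n (interval a b) (interval c d))
intervals-isICS {n} {a} {b} {c} {d} compatible =
  fromRows-isICS {n} (interval-convex a b) (interval-convex c d) (interval-linked compatible)

fromRows-violated : ∀ {n r₁ r₂} (u v w : Fin 2) {i j k} → toℕ u ≤ toℕ v → toℕ v ≤ toℕ w →
  i ≤ j → j ≤ k → k < n → rowOf u r₁ r₂ i ≡ true → rowOf v r₁ r₂ j ≡ false → rowOf w r₁ r₂ k ≡ true →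
  isICS (fromRows n r₁ r₂) ≡ false
fromRows-violated {n} {r₁} {r₂} u v w {i} {j} {k} u≤v v≤w i≤j j≤k k<n i∈ j∉ k∈ =
  isICS-violated (fromRows n r₁ r₂) {low} {high} {middle}
    (member u i<n i∈) (member w k<n k∈)
    (≼-intro u≤v (subst₂ _≤_ (sym (Fin.toℕ-fromℕ< i<n)) (sym (Fin.toℕ-fromℕ< j<n)) i≤j))
    (≼-intro v≤w (subst₂ _≤_ (sym (Fin.toℕ-fromℕ< j<n)) (sym (Fin.toℕ-fromℕ< k<n)) j≤k))
    (member v j<n j∉)
  where
  j<n : j < n
  j<n = ≤-<-trans j≤k k<n
  i<n : i < n
  i<n = ≤-<-trans i≤j j<n
  low middle high : Elt n
  low = (u , fromℕ< i<n)
  middle = (v , fromℕ< j<n)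
  high = (w , fromℕ< k<n)
  member : ∀ {a b} (e : Fin 2) (a<n : a < n) → rowOf e r₁ r₂ a ≡ b → ((e , fromℕ< a<n) ∈? fromRows n r₁ r₂) ≡ b
  member e a<n a∈ = trans (∈?-fromRows r₁ r₂ (e , fromℕ< a<n)) (trans (cong (rowOf e r₁ r₂) (Fin.toℕ-fromℕ< a<n)) a∈)

notICS₁₁₁ : ∀ {n r₁ r₂ i j k} → i ≤ j → j ≤ k → k < n →
  r₁ i ≡ true → r₁ j ≡ false → r₁ k ≡ true → isICS (fromRows n r₁ r₂) ≡ false
notICS₁₁₁ = fromRows-violated fzero fzero fzero z≤n z≤n

notICS₂₂₂ : ∀ {n r₁ r₂ i j k} → i ≤ j → j ≤ k → k < n →
  r₂ i ≡ true → r₂ j ≡ false → r₂ k ≡ true → isICS (fromRows n r₁ r₂) ≡ false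
notICS₂₂₂ = fromRows-violated (fsuc fzero) (fsuc fzero) (fsuc fzero) ≤-refl ≤-refl

notICS₁₁₂ : ∀ {n r₁ r₂ i j k} → i ≤ j → j ≤ k → k < n →
  r₁ i ≡ true → r₁ j ≡ false → r₂ k ≡ true → isICS (fromRows n r₁ r₂) ≡ false
notICS₁₁₂ = fromRows-violated fzero fzero (fsuc fzero) z≤n z≤n

notICS₁₂₂ : ∀ {n r₁ r₂ i j k} → i ≤ j → j ≤ k → k < n →
  r₁ i ≡ true → r₂ j ≡ false → r₂ k ≡ true → isICS (fromRows n r₁ r₂) ≡ false
notICS₁₂₂ = fromRows-violated fzero (fsuc fzero) (fsuc fzero) z≤n ≤-refl

-- Rowmotion as a sweep over the columns

toggle-accept : ∀ {n} (x : Elt n) {I J} → flipAt x I ≡ J → IsICS J → toggle x I ≡ J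
toggle-accept x refl ics rewrite ics = refl

toggle-reject : ∀ {n} (x : Elt n) {I J} → flipAt x I ≡ J → isICS J ≡ false → toggle x I ≡ I
toggle-reject x refl ¬ics rewrite ¬ics = refl

flipAt-column₁ : ∀ {n k} (k<n : k < n) r₁ r₂ →
  flipAt (fzero , fromℕ< k<n) (fromRows n r₁ r₂) ≡ fromRows n (invertAt k r₁) r₂
flipAt-column₁ {n} k<n r₁ r₂ =
  trans (flipAt-fromRows₁ r₁ r₂ (fromℕ< k<n)) (cong (λ c → fromRows n (invertAt c r₁) r₂) (Fin.toℕ-fromℕ< k<n))

flipAt-column₂ : ∀ {n k} (k<n : k < n) r₁ r₂ →
  flipAt (fsuc fzero , fromℕ< k<n) (fromRows n r₁ r₂) ≡ fromRows n r₁ (invertAt k r₂)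
flipAt-column₂ {n} k<n r₁ r₂ =
  trans (flipAt-fromRows₂ r₁ r₂ (fromℕ< k<n)) (cong (λ c → fromRows n r₁ (invertAt c r₂)) (Fin.toℕ-fromℕ< k<n))

toggle₁-accept : ∀ {n k r₁ a b c d} (k<n : k < n) → invertAt k r₁ ≗ interval a b → Compatible a b c d →
  toggle (fzero , fromℕ< k<n) (fromRows n r₁ (interval c d)) ≡ fromRows n (interval a b) (interval c d)
toggle₁-accept {n} {r₁ = r₁} {a} {b} {c} {d} k<n inverted compatible = toggle-accept (fzero , fromℕ< k<n)
  (trans (flipAt-column₁ k<n r₁ _) (fromRows-cong inverted (λ _ → refl))) (intervals-isICS {n} {a} {b} {c} {d} compatible)

toggle₂-accept : ∀ {n k r₂ a b c d} (k<n : k < n) → invertAt k r₂ ≗ interval c d → Compatible a b c d →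
  toggle (fsuc fzero , fromℕ< k<n) (fromRows n (interval a b) r₂) ≡ fromRows n (interval a b) (interval c d)
toggle₂-accept {n} {r₂ = r₂} {a} {b} {c} {d} k<n inverted compatible = toggle-accept (fsuc fzero , fromℕ< k<n)
  (trans (flipAt-column₂ k<n _ r₂) (fromRows-cong (λ _ → refl) inverted)) (intervals-isICS {n} {a} {b} {c} {d} compatible)

toggle₁-reject : ∀ {n k r₁ r₂} (k<n : k < n) → isICS (fromRows n (invertAt k r₁) r₂) ≡ false →
  toggle (fzero , fromℕ< k<n) (fromRows n r₁ r₂) ≡ fromRows n r₁ r₂
toggle₁-reject k<n = toggle-reject (fzero , fromℕ< k<n) (flipAt-column₁ k<n _ _)

toggle₂-reject : ∀ {n k r₁ r₂} (k<n : k < n) → isICS (fromRows n r₁ (invertAt k r₂)) ≡ false →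
  toggle (fsuc fzero , fromℕ< k<n) (fromRows n r₁ r₂) ≡ fromRows n r₁ r₂
toggle₂-reject k<n = toggle-reject (fsuc fzero , fromℕ< k<n) (flipAt-column₂ k<n _ _)

-- The two toggles of column k + 1, in the order in which Row applies them.
toggleColumn : ∀ {n} → ℕ → Sub n → Sub n
toggleColumn {n} k S with k <? n
... | yes k<n = toggle (fzero , fromℕ< k<n) (toggle (fsuc fzero , fromℕ< k<n) S)
... | no _    = S

toggleColumn-fromRows : ∀ {n k r₁ r₂ s₁ s₂} (k<n : k < n) →
  toggle (fsuc fzero , fromℕ< k<n) (fromRows n r₁ r₂) ≡ fromRows n r₁ s₂ →
  toggle (fzero , fromℕ< k<n) (fromRows n r₁ s₂) ≡ fromRows n s₁ s₂ →
  toggleColumn k (fromRows n r₁ r₂) ≡ fromRows n s₁ s₂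
toggleColumn-fromRows {n} {k} k<n second first with k <? n
... | yes k<n′ rewrite <-irrelevant k<n′ k<n | second = first
... | no k≮n = contradiction k<n k≮n

sweepFrom : ∀ {n} → ℕ → ℕ → Sub n → Sub n
sweepFrom lo zero    S = S
sweepFrom lo (suc m) S = toggleColumn lo (sweepFrom (suc lo) m S)

sweep : ∀ {n} → ℕ → ℕ → Sub n → Sub n
sweep lo hi = sweepFrom lo (hi ∸ lo)

Row≡sweep : ∀ {n} (S : Sub n) → Row S ≡ sweep 0 n S
Row≡sweep {n} S = trans (foldToggles-columns (allFin n)) (foldr-tabulate n (λ i → i) 0 (λ i → refl))
  where
  columnStep : Fin n → Sub n → Sub n
  columnStep j = toggle (fzero , j) ∘ toggle (fsuc fzero , j)

  foldToggles-columns : ∀ js → foldToggles (concatMap (λ j → (fzero , j) ∷ (fsuc fzero , j) ∷ []) js) S ≡ foldr columnStep S js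
  foldToggles-columns []       = refl
  foldToggles-columns (j ∷ js) = cong (columnStep j) (foldToggles-columns js)

  foldr-tabulate : ∀ m (f : Fin m → Fin n) lo → (∀ i → toℕ (f i) ≡ lo + toℕ i) →
    foldr columnStep S (List.tabulate f) ≡ sweepFrom lo m S
  foldr-tabulate zero    f lo f≡ = refl
  foldr-tabulate (suc m) f lo f≡ with lo <? n
  ... | no lo≮n = contradiction (subst (_< n) (trans (f≡ fzero) (+-identityʳ lo)) (Fin.toℕ<n (f fzero))) lo≮n
  ... | yes lo<n rewrite foldr-tabulate m (f ∘ fsuc) (suc lo) (λ i → trans (f≡ (fsuc i)) (+-suc lo (toℕ i)))
                       | Fin.toℕ-injective {i = f fzero} {j = fromℕ< lo<n}
                           (trans (trans (f≡ fzero) (+-identityʳ lo)) (sym (Fin.toℕ-fromℕ< lo<n)))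
                       = refl

sweepFrom-+ : ∀ {n} lo m m′ (S : Sub n) → sweepFrom lo (m + m′) S ≡ sweepFrom lo m (sweepFrom (lo + m) m′ S)
sweepFrom-+ lo zero    m′ S = cong (λ l → sweepFrom l m′ S) (sym (+-identityʳ lo))
sweepFrom-+ lo (suc m) m′ S = cong (toggleColumn lo)
  (trans (sweepFrom-+ (suc lo) m m′ S) (cong (λ l → sweepFrom (suc lo) m (sweepFrom l m′ S)) (sym (+-suc lo m))))

sweep-split : ∀ {n} {lo mid hi} (S : Sub n) → lo ≤ mid → mid ≤ hi → sweep lo hi S ≡ sweep lo mid (sweep mid hi S)
sweep-split {lo = lo} {mid} {hi} S lo≤mid mid≤hi = begin
  sweepFrom lo (hi ∸ lo) S
    ≡⟨ cong (λ m → sweepFrom lo m S) lengths ⟨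
  sweepFrom lo ((mid ∸ lo) + (hi ∸ mid)) S
    ≡⟨ sweepFrom-+ lo (mid ∸ lo) (hi ∸ mid) S ⟩
  sweepFrom lo (mid ∸ lo) (sweepFrom (lo + (mid ∸ lo)) (hi ∸ mid) S)
    ≡⟨ cong (λ l → sweepFrom lo (mid ∸ lo) (sweepFrom l (hi ∸ mid) S)) (m+[n∸m]≡n lo≤mid) ⟩
  sweepFrom lo (mid ∸ lo) (sweepFrom mid (hi ∸ mid) S) ∎
  where
  open ≡-Reasoning
  lengths : (mid ∸ lo) + (hi ∸ mid) ≡ hi ∸ lo
  lengths = trans (+-comm (mid ∸ lo) (hi ∸ mid))
              (trans (sym (+-∸-assoc (hi ∸ mid) lo≤mid)) (cong (_∸ lo) (m∸n+n≡m mid≤hi)))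

sweep-evolve : ∀ {n} (St : ℕ → Sub n) {lo hi} → lo ≤ hi →
  (∀ k → lo ≤ k → k < hi → toggleColumn k (St (suc k)) ≡ St k) → sweep lo hi (St hi) ≡ St lo
sweep-evolve St {lo} {hi} lo≤hi step =
  trans (cong (λ h → sweepFrom lo (hi ∸ lo) (St h)) (sym (m+[n∸m]≡n lo≤hi)))
    (go lo (hi ∸ lo) (λ k lo≤k k<hi → step k lo≤k (subst (k <_) (m+[n∸m]≡n lo≤hi) k<hi)))
  where
  go : ∀ lo m → (∀ k → lo ≤ k → k < lo + m → toggleColumn k (St (suc k)) ≡ St k) → sweepFrom lo m (St (lo + m)) ≡ St lo
  go lo zero    step′ = cong St (+-identityʳ lo)
  go lo (suc m) step′ = begin
    toggleColumn lo (sweepFrom (suc lo) m (St (lo + suc m)))  ≡⟨ cong (λ h → toggleColumn lo (sweepFrom (suc lo) m (St h))) (+-suc lo m) ⟩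
    toggleColumn lo (sweepFrom (suc lo) m (St (suc lo + m)))
      ≡⟨ cong (toggleColumn lo) (go (suc lo) m (λ k lo<k k<hi → step′ k (<⇒≤ lo<k) (subst (k <_) (sym (+-suc lo m)) k<hi))) ⟩
    toggleColumn lo (St (suc lo))                             ≡⟨ step′ lo ≤-refl (m<m+n lo z<s) ⟩
    St lo                                                     ∎
    where open ≡-Reasoning

sweep-fixed : ∀ {n} (S : Sub n) {lo hi} → (∀ k → lo ≤ k → k < hi → toggleColumn k S ≡ S) → sweep lo hi S ≡ S
sweep-fixed S {lo} {hi} fixed with lo ≤? hi
... | yes lo≤hi = sweep-evolve (λ _ → S) lo≤hi fixed
... | no lo≰hi = cong (λ m → sweepFrom lo m S) (m≤n⇒m∸n≡0 (<⇒≤ (≰⇒> lo≰hi)))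

sweep-column : ∀ {n} (S : Sub n) k → sweep k (suc k) S ≡ toggleColumn k S
sweep-column S k rewrite m+n∸n≡m 1 k = refl

sweep-empty : ∀ {n} (S : Sub n) k → sweep k k S ≡ S
sweep-empty S k rewrite n∸n≡0 k = refl

sweep-compose : ∀ {n lo mid hi} {S S′ S″ : Sub n} → lo ≤ mid → mid ≤ hi →
  sweep mid hi S ≡ S′ → sweep lo mid S′ ≡ S″ → sweep lo hi S ≡ S″
sweep-compose {lo = lo} {mid} {S = S} lo≤mid mid≤hi upper lower =
  trans (sweep-split S lo≤mid mid≤hi) (trans (cong (sweep lo mid) upper) lower)

sweep-through : ∀ {n lo hi} k {S S′ S″ S‴ : Sub n} → lo ≤ k → k < hi →
  sweep (suc k) hi S ≡ S′ → toggleColumn k S′ ≡ S″ → sweep lo k S″ ≡ S‴ → sweep lo hi S ≡ S‴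
sweep-through k lo≤k k<hi upper column lower =
  sweep-compose lo≤k (<⇒≤ k<hi) (sweep-compose (n≤1+n k) k<hi upper (trans (sweep-column _ k) column)) lower

sweep-rejects : ∀ {n r₁ r₂} lo hi →
  (∀ k → lo ≤ k → k < hi → (k<n : k < n) → isICS (fromRows n r₁ (invertAt k r₂)) ≡ false) →
  (∀ k → lo ≤ k → k < hi → (k<n : k < n) → isICS (fromRows n (invertAt k r₁) r₂) ≡ false) →
  hi ≤ n → sweep lo hi (fromRows n r₁ r₂) ≡ fromRows n r₁ r₂
sweep-rejects lo hi reject₂ reject₁ hi≤n = sweep-fixed _ λ k lo≤k k<hi →
  let k<n = <-≤-trans k<hi hi≤n in
  toggleColumn-fromRows k<n (toggle₂-reject k<n (reject₂ k lo≤k k<hi k<n)) (toggle₁-reject k<n (reject₁ k lo≤k k<hi k<n))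

sweep-moves : ∀ {n} (f₁ f₂ : ℕ → ℕ → Bool) lo hi → lo ≤ hi → hi ≤ n →
  (∀ k → lo ≤ k → k < hi → (k<n : k < n) →
    toggle (fsuc fzero , fromℕ< k<n) (fromRows n (f₁ (suc k)) (f₂ (suc k))) ≡ fromRows n (f₁ (suc k)) (f₂ k)) →
  (∀ k → lo ≤ k → k < hi → (k<n : k < n) →
    toggle (fzero , fromℕ< k<n) (fromRows n (f₁ (suc k)) (f₂ k)) ≡ fromRows n (f₁ k) (f₂ k)) →
  sweep lo hi (fromRows n (f₁ hi) (f₂ hi)) ≡ fromRows n (f₁ lo) (f₂ lo)
sweep-moves {n} f₁ f₂ lo hi lo≤hi hi≤n step₂ step₁ = sweep-evolve (λ k → fromRows n (f₁ k) (f₂ k)) lo≤hi λ k lo≤k k<hi →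
  let k<n = <-≤-trans k<hi hi≤n in toggleColumn-fromRows k<n (step₂ k lo≤k k<hi k<n) (step₁ k lo≤k k<hi k<n)

-- One rowmotion step on a two-interval set

module _ {n : ℕ} where

  ⟦_,_∣_,_⟧ : ℕ → ℕ → ℕ → ℕ → Sub n
  ⟦ a , b ∣ c , d ⟧ = fromRows n (interval a b) (interval c d)

  Row-staircase : ∀ {c d b} → c < d → d < b → b < n → Row ⟦ d , b ∣ c , d ⟧ ≡ ⟦ suc d , suc b ∣ suc c , suc d ⟧
  Row-staircase {c} {d} {b} c<d d<b b<n =
    trans (Row≡sweep _)
      (sweep-through b z≤n b<n above-b column-b (sweep-through d z≤n d<b inside column-d (sweep-through c z≤n c<d left column-c below-c)))
    where
    d<n : d < n
    d<n = <-trans d<b b<n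
    c<n : c < n
    c<n = <-trans c<d d<n
    above-b : sweep (suc b) n ⟦ d , b ∣ c , d ⟧ ≡ ⟦ d , b ∣ c , d ⟧
    above-b = sweep-rejects (suc b) n
      (λ j b<j _ j<n → notICS₁₁₂ {i = d} {b} {j} (<⇒≤ d<b) (<⇒≤ b<j) j<n
                         (interval-∈ ≤-refl d<b)
                         (interval-≥ ≤-refl)
                         (invertAt-on (interval-≥ (≤-trans (<⇒≤ d<b) (<⇒≤ b<j)))))
      (λ j b<j _ j<n → notICS₁₁₁ {i = d} {b} {j} (<⇒≤ d<b) (<⇒≤ b<j) j<n
                         (invertAt-there (<⇒≢ (<-trans d<b b<j)) (interval-∈ ≤-refl d<b))
                         (invertAt-there (<⇒≢ b<j) (interval-≥ ≤-refl))
                         (invertAt-on (interval-≥ (<⇒≤ b<j))))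
      ≤-refl
    column-b : toggleColumn b ⟦ d , b ∣ c , d ⟧ ≡ ⟦ d , suc b ∣ c , d ⟧
    column-b = toggleColumn-fromRows b<n
      (toggle₂-reject b<n (notICS₁₂₂ {i = d} {d} {b} ≤-refl (<⇒≤ d<b) b<n
                             (interval-∈ ≤-refl d<b)
                             (invertAt-there (<⇒≢ d<b) (interval-≥ ≤-refl))
                             (invertAt-on (interval-≥ (<⇒≤ d<b)))))
      (toggle₁-accept b<n (invertAt-extendʳ (<⇒≤ d<b)) (row₂-left ≤-refl))
    inside : sweep (suc d) b ⟦ d , suc b ∣ c , d ⟧ ≡ ⟦ d , suc b ∣ c , d ⟧
    inside = sweep-rejects (suc d) b
      (λ j d<j _ j<n → notICS₁₂₂ {i = d} {d} {j} ≤-refl (<⇒≤ d<j) j<n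
                         (interval-∈ ≤-refl (m<n⇒m<1+n d<b))
                         (invertAt-there (<⇒≢ d<j) (interval-≥ ≤-refl))
                         (invertAt-on (interval-≥ (<⇒≤ d<j))))
      (λ j d<j j<b _ → notICS₁₁₁ {i = d} {j} {b} (<⇒≤ d<j) (<⇒≤ j<b) b<n
                         (invertAt-there (<⇒≢ d<j) (interval-∈ ≤-refl (m<n⇒m<1+n d<b)))
                         (invertAt-off (interval-∈ (<⇒≤ d<j) (m<n⇒m<1+n j<b)))
                         (invertAt-there (>⇒≢ j<b) (interval-∈ (<⇒≤ d<b) (n<1+n b))))
      (<⇒≤ b<n)
    column-d : toggleColumn d ⟦ d , suc b ∣ c , d ⟧ ≡ ⟦ suc d , suc b ∣ c , suc d ⟧
    column-d = toggleColumn-fromRows d<n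
      (toggle₂-accept d<n (invertAt-extendʳ (<⇒≤ c<d)) (shifted (<⇒≤ c<d) (s≤s (<⇒≤ d<b))))
      (toggle₁-accept d<n (invertAt-shrinkˡ (m<n⇒m<1+n d<b)) (row₂-left ≤-refl))
    left : sweep (suc c) d ⟦ suc d , suc b ∣ c , suc d ⟧ ≡ ⟦ suc d , suc b ∣ c , suc d ⟧
    left = sweep-rejects (suc c) d
      (λ j c<j j<d _ → notICS₂₂₂ {i = c} {j} {d} (<⇒≤ c<j) (<⇒≤ j<d) d<n
                         (invertAt-there (<⇒≢ c<j) (interval-∈ ≤-refl (m<n⇒m<1+n c<d)))
                         (invertAt-off (interval-∈ (<⇒≤ c<j) (m<n⇒m<1+n j<d)))
                         (invertAt-there (>⇒≢ j<d) (interval-∈ (<⇒≤ c<d) (n<1+n d))))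
      (λ j _ j<d _ → notICS₁₁₂ {i = j} {d} {d} (<⇒≤ j<d) ≤-refl d<n
                       (invertAt-on (interval-< (m<n⇒m<1+n j<d)))
                       (invertAt-there (>⇒≢ j<d) (interval-< (n<1+n d)))
                       (interval-∈ (<⇒≤ c<d) (n<1+n d)))
      (<⇒≤ d<n)
    column-c : toggleColumn c ⟦ suc d , suc b ∣ c , suc d ⟧ ≡ ⟦ suc d , suc b ∣ suc c , suc d ⟧
    column-c = toggleColumn-fromRows c<n
      (toggle₂-accept c<n (invertAt-shrinkˡ (m<n⇒m<1+n c<d)) (row₂-left ≤-refl))
      (toggle₁-reject c<n (notICS₁₁₂ {i = c} {d} {d} (<⇒≤ c<d) ≤-refl d<n
                             (invertAt-on (interval-< (m<n⇒m<1+n c<d)))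
                             (invertAt-there (>⇒≢ c<d) (interval-< (n<1+n d)))
                             (interval-∈ c<d (n<1+n d))))
    below-c : sweep 0 c ⟦ suc d , suc b ∣ suc c , suc d ⟧ ≡ ⟦ suc d , suc b ∣ suc c , suc d ⟧
    below-c = sweep-rejects 0 c
      (λ j _ j<c _ → notICS₂₂₂ {i = j} {c} {d} (<⇒≤ j<c) (<⇒≤ c<d) d<n
                       (invertAt-on (interval-< (m<n⇒m<1+n j<c)))
                       (invertAt-there (>⇒≢ j<c) (interval-< (n<1+n c)))
                       (invertAt-there (>⇒≢ (<-trans j<c c<d)) (interval-∈ c<d (n<1+n d))))
      (λ j _ j<c _ → notICS₁₁₂ {i = j} {d} {d} (<⇒≤ (<-trans j<c c<d)) ≤-refl d<n
                       (invertAt-on (interval-< (m<n⇒m<1+n (<-trans j<c c<d))))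
                       (invertAt-there (>⇒≢ (<-trans j<c c<d)) (interval-< (n<1+n d)))
                       (interval-∈ c<d (n<1+n d)))
      (<⇒≤ c<n)

  Row-lower : ∀ {a b} → a < b → b < n → Row ⟦ a , b ∣ 0 , 0 ⟧ ≡ ⟦ suc a , suc b ∣ 0 , suc a ⟧
  Row-lower {a} {b} a<b b<n =
    trans (Row≡sweep _) (sweep-through b z≤n b<n above-b column-b (sweep-through a z≤n a<b inside column-a below-a))
    where
    a<n : a < n
    a<n = <-trans a<b b<n
    above-b : sweep (suc b) n ⟦ a , b ∣ 0 , 0 ⟧ ≡ ⟦ a , b ∣ 0 , 0 ⟧
    above-b = sweep-rejects (suc b) n
      (λ j b<j _ j<n → notICS₁₁₂ {i = a} {b} {j} (<⇒≤ a<b) (<⇒≤ b<j) j<n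
                         (interval-∈ ≤-refl a<b)
                         (interval-≥ ≤-refl)
                         (invertAt-on (interval-≥ z≤n)))
      (λ j b<j _ j<n → notICS₁₁₁ {i = a} {b} {j} (<⇒≤ a<b) (<⇒≤ b<j) j<n
                         (invertAt-there (<⇒≢ (<-trans a<b b<j)) (interval-∈ ≤-refl a<b))
                         (invertAt-there (<⇒≢ b<j) (interval-≥ ≤-refl))
                         (invertAt-on (interval-≥ (<⇒≤ b<j))))
      ≤-refl
    column-b : toggleColumn b ⟦ a , b ∣ 0 , 0 ⟧ ≡ ⟦ a , suc b ∣ 0 , 0 ⟧
    column-b = toggleColumn-fromRows b<n
      (toggle₂-reject b<n (notICS₁₂₂ {i = a} {a} {b} ≤-refl (<⇒≤ a<b) b<n
                             (interval-∈ ≤-refl a<b)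
                             (invertAt-there (<⇒≢ a<b) (interval-≥ z≤n))
                             (invertAt-on (interval-≥ z≤n))))
      (toggle₁-accept b<n (invertAt-extendʳ (<⇒≤ a<b)) (row₂-empty z≤n))
    inside : sweep (suc a) b ⟦ a , suc b ∣ 0 , 0 ⟧ ≡ ⟦ a , suc b ∣ 0 , 0 ⟧
    inside = sweep-rejects (suc a) b
      (λ j a<j _ j<n → notICS₁₂₂ {i = a} {a} {j} ≤-refl (<⇒≤ a<j) j<n
                         (interval-∈ ≤-refl (m<n⇒m<1+n a<b))
                         (invertAt-there (<⇒≢ a<j) (interval-≥ z≤n))
                         (invertAt-on (interval-≥ z≤n)))
      (λ j a<j j<b _ → notICS₁₁₁ {i = a} {j} {b} (<⇒≤ a<j) (<⇒≤ j<b) b<n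
                         (invertAt-there (<⇒≢ a<j) (interval-∈ ≤-refl (m<n⇒m<1+n a<b)))
                         (invertAt-off (interval-∈ (<⇒≤ a<j) (m<n⇒m<1+n j<b)))
                         (invertAt-there (>⇒≢ j<b) (interval-∈ (<⇒≤ a<b) (n<1+n b))))
      (<⇒≤ b<n)
    column-a : toggleColumn a ⟦ a , suc b ∣ 0 , 0 ⟧ ≡ ⟦ suc a , suc b ∣ a , suc a ⟧
    column-a = toggleColumn-fromRows a<n
      (toggle₂-accept a<n (invertAt-empty z≤n) (shifted ≤-refl (s≤s (<⇒≤ a<b))))
      (toggle₁-accept a<n (invertAt-shrinkˡ (m<n⇒m<1+n a<b)) (row₂-left ≤-refl))
    below-a : sweep 0 a ⟦ suc a , suc b ∣ a , suc a ⟧ ≡ ⟦ suc a , suc b ∣ 0 , suc a ⟧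
    below-a = sweep-moves (λ _ → interval (suc a) (suc b)) (λ j → interval j (suc a)) 0 a z≤n (<⇒≤ a<n)
      (λ k _ k<a k<n → toggle₂-accept k<n (invertAt-extendˡ (m<n⇒m<1+n k<a)) (row₂-left ≤-refl))
      (λ k _ k<a k<n → toggle₁-reject k<n (notICS₁₁₂ {i = k} {a} {a} (<⇒≤ k<a) ≤-refl a<n
                                             (invertAt-on (interval-< (m<n⇒m<1+n k<a)))
                                             (invertAt-there (>⇒≢ k<a) (interval-< (n<1+n a)))
                                             (interval-∈ (<⇒≤ k<a) (n<1+n a))))

  Row-lower-end : ∀ {a} → a < n → Row ⟦ a , n ∣ 0 , 0 ⟧ ≡ ⟦ 0 , 0 ∣ 0 , suc a ⟧
  Row-lower-end {a} a<n =
    trans (Row≡sweep _) (trans (sweep-compose z≤n a<n above-a (sweep-through a z≤n (n<1+n a) (sweep-empty _ (suc a)) column-a below-a))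
      (fromRows-cong (interval-empty-≗ ≤-refl z≤n) (λ _ → refl)))
    where
    above-a : sweep (suc a) n ⟦ a , n ∣ 0 , 0 ⟧ ≡ ⟦ a , suc a ∣ 0 , 0 ⟧
    above-a = sweep-moves (λ j → interval a j) (λ _ → interval 0 0) (suc a) n a<n ≤-refl
      (λ k a<k _ k<n → toggle₂-reject k<n (notICS₁₂₂ {i = a} {a} {k} ≤-refl (<⇒≤ a<k) k<n
                                             (interval-∈ ≤-refl (m<n⇒m<1+n a<k))
                                             (invertAt-there (<⇒≢ a<k) (interval-≥ z≤n))
                                             (invertAt-on (interval-≥ z≤n))))
      (λ k a<k _ k<n → toggle₁-accept k<n (invertAt-shrinkʳ (<⇒≤ a<k)) (row₂-empty z≤n))
    column-a : toggleColumn a ⟦ a , suc a ∣ 0 , 0 ⟧ ≡ ⟦ a , a ∣ a , suc a ⟧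
    column-a = toggleColumn-fromRows a<n
      (toggle₂-accept a<n (invertAt-empty z≤n) (shifted ≤-refl ≤-refl))
      (toggle₁-accept a<n (invertAt-shrinkʳ ≤-refl) (row₁-empty ≤-refl))
    below-a : sweep 0 a ⟦ a , a ∣ a , suc a ⟧ ≡ ⟦ a , a ∣ 0 , suc a ⟧
    below-a = sweep-moves (λ _ → interval a a) (λ j → interval j (suc a)) 0 a z≤n (<⇒≤ a<n)
      (λ k _ k<a k<n → toggle₂-accept k<n (invertAt-extendˡ (m<n⇒m<1+n k<a)) (row₁-empty ≤-refl))
      (λ k _ k<a k<n → toggle₁-reject k<n (notICS₁₁₂ {i = k} {suc k} {a} (n≤1+n k) k<a a<n
                                             (invertAt-on (interval-empty ≤-refl k))
                                             (invertAt-there (>⇒≢ (n<1+n k)) (interval-empty ≤-refl (suc k)))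
                                             (interval-∈ (<⇒≤ k<a) (n<1+n a))))

  Row-staircase-end : ∀ {c d} → c < d → d < n → Row ⟦ d , n ∣ c , d ⟧ ≡ ⟦ 0 , 0 ∣ suc c , suc d ⟧
  Row-staircase-end {c} {d} c<d d<n =
    trans (Row≡sweep _) (trans (sweep-compose z≤n d<n above-d (sweep-through d z≤n (n<1+n d) (sweep-empty _ (suc d)) column-d
                                  (sweep-through c z≤n c<d inside column-c below-c)))
      (fromRows-cong (interval-empty-≗ ≤-refl z≤n) (λ _ → refl)))
    where
    c<n : c < n
    c<n = <-trans c<d d<n
    above-d : sweep (suc d) n ⟦ d , n ∣ c , d ⟧ ≡ ⟦ d , suc d ∣ c , d ⟧
    above-d = sweep-moves (λ j → interval d j) (λ _ → interval c d) (suc d) n d<n ≤-refl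
      (λ k d<k _ k<n → toggle₂-reject k<n (notICS₁₂₂ {i = d} {d} {k} ≤-refl (<⇒≤ d<k) k<n
                                             (interval-∈ ≤-refl (m<n⇒m<1+n d<k))
                                             (invertAt-there (<⇒≢ d<k) (interval-≥ ≤-refl))
                                             (invertAt-on (interval-≥ (<⇒≤ d<k)))))
      (λ k d<k _ k<n → toggle₁-accept k<n (invertAt-shrinkʳ (<⇒≤ d<k)) (row₂-left ≤-refl))
    column-d : toggleColumn d ⟦ d , suc d ∣ c , d ⟧ ≡ ⟦ d , d ∣ c , suc d ⟧
    column-d = toggleColumn-fromRows d<n
      (toggle₂-accept d<n (invertAt-extendʳ (<⇒≤ c<d)) (shifted (<⇒≤ c<d) ≤-refl))
      (toggle₁-accept d<n (invertAt-shrinkʳ ≤-refl) (row₁-empty ≤-refl))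
    inside : sweep (suc c) d ⟦ d , d ∣ c , suc d ⟧ ≡ ⟦ d , d ∣ c , suc d ⟧
    inside = sweep-rejects (suc c) d
      (λ j c<j j<d _ → notICS₂₂₂ {i = c} {j} {d} (<⇒≤ c<j) (<⇒≤ j<d) d<n
                         (invertAt-there (<⇒≢ c<j) (interval-∈ ≤-refl (m<n⇒m<1+n c<d)))
                         (invertAt-off (interval-∈ (<⇒≤ c<j) (m<n⇒m<1+n j<d)))
                         (invertAt-there (>⇒≢ j<d) (interval-∈ (<⇒≤ c<d) (n<1+n d))))
      (λ j c<j j<d _ → notICS₁₁₂ {i = j} {suc j} {d} (n≤1+n j) j<d d<n
                         (invertAt-on (interval-empty ≤-refl j))
                         (invertAt-there (>⇒≢ (n<1+n j)) (interval-empty ≤-refl (suc j)))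
                         (interval-∈ (<⇒≤ (<-trans c<j j<d)) (n<1+n d)))
      (<⇒≤ d<n)
    column-c : toggleColumn c ⟦ d , d ∣ c , suc d ⟧ ≡ ⟦ d , d ∣ suc c , suc d ⟧
    column-c = toggleColumn-fromRows c<n
      (toggle₂-accept c<n (invertAt-shrinkˡ (m<n⇒m<1+n c<d)) (row₁-empty ≤-refl))
      (toggle₁-reject c<n (notICS₁₁₂ {i = c} {suc c} {d} (n≤1+n c) c<d d<n
                             (invertAt-on (interval-empty ≤-refl c))
                             (invertAt-there (>⇒≢ (n<1+n c)) (interval-empty ≤-refl (suc c)))
                             (interval-∈ c<d (n<1+n d))))
    below-c : sweep 0 c ⟦ d , d ∣ suc c , suc d ⟧ ≡ ⟦ d , d ∣ suc c , suc d ⟧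
    below-c = sweep-rejects 0 c
      (λ j _ j<c _ → notICS₂₂₂ {i = j} {c} {d} (<⇒≤ j<c) (<⇒≤ c<d) d<n
                       (invertAt-on (interval-< (m<n⇒m<1+n j<c)))
                       (invertAt-there (>⇒≢ j<c) (interval-< (n<1+n c)))
                       (invertAt-there (>⇒≢ (<-trans j<c c<d)) (interval-∈ c<d (n<1+n d))))
      (λ j _ j<c _ → notICS₁₁₂ {i = j} {suc j} {d} (n≤1+n j) (<-trans j<c c<d) d<n
                       (invertAt-on (interval-empty ≤-refl j))
                       (invertAt-there (>⇒≢ (n<1+n j)) (interval-empty ≤-refl (suc j)))
                       (interval-∈ c<d (n<1+n d)))
      (<⇒≤ c<n)

  Row-upper : ∀ {c d} → c < d → d < n → Row ⟦ 0 , 0 ∣ c , d ⟧ ≡ ⟦ suc c , n ∣ suc c , suc d ⟧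
  Row-upper {c} {d} c<d d<n =
    trans (cong Row (fromRows-cong (interval-empty-≗ z≤n ≤-refl) (λ _ → refl)))
      (trans (Row≡sweep _) (sweep-compose z≤n d<n above-d (sweep-through d z≤n (n<1+n d) (sweep-empty _ (suc d)) column-d
                             (sweep-compose z≤n c<d inside (sweep-through c z≤n (n<1+n c) (sweep-empty _ (suc c)) column-c below-c)))))
    where
    c<n : c < n
    c<n = <-trans c<d d<n
    above-d : sweep (suc d) n ⟦ n , n ∣ c , d ⟧ ≡ ⟦ suc d , n ∣ c , d ⟧
    above-d = sweep-moves (λ j → interval j n) (λ _ → interval c d) (suc d) n d<n ≤-refl
      (λ k d<k _ k<n → toggle₂-reject k<n (notICS₂₂₂ {i = c} {d} {k} (<⇒≤ c<d) (<⇒≤ d<k) k<n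
                                             (invertAt-there (<⇒≢ (<-trans c<d d<k)) (interval-∈ ≤-refl c<d))
                                             (invertAt-there (<⇒≢ d<k) (interval-≥ ≤-refl))
                                             (invertAt-on (interval-≥ (<⇒≤ d<k)))))
      (λ k d<k _ k<n → toggle₁-accept k<n (invertAt-extendˡ k<n) (row₂-left (<⇒≤ d<k)))
    column-d : toggleColumn d ⟦ suc d , n ∣ c , d ⟧ ≡ ⟦ d , n ∣ c , suc d ⟧
    column-d = toggleColumn-fromRows d<n
      (toggle₂-accept d<n (invertAt-extendʳ (<⇒≤ c<d)) (row₂-left ≤-refl))
      (toggle₁-accept d<n (invertAt-extendˡ d<n) (shifted (<⇒≤ c<d) d<n))
    inside : sweep (suc c) d ⟦ d , n ∣ c , suc d ⟧ ≡ ⟦ suc c , n ∣ c , suc d ⟧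
    inside = sweep-moves (λ j → interval j n) (λ _ → interval c (suc d)) (suc c) d c<d (<⇒≤ d<n)
      (λ k c<k k<d _ → toggle₂-reject (<-trans k<d d<n) (notICS₂₂₂ {i = c} {k} {d} (<⇒≤ c<k) (<⇒≤ k<d) d<n
                                                           (invertAt-there (<⇒≢ c<k) (interval-∈ ≤-refl (m<n⇒m<1+n c<d)))
                                                           (invertAt-off (interval-∈ (<⇒≤ c<k) (m<n⇒m<1+n k<d)))
                                                           (invertAt-there (>⇒≢ k<d) (interval-∈ (<⇒≤ c<d) (n<1+n d)))))
      (λ k c<k _ k<n → toggle₁-accept k<n (invertAt-extendˡ k<n) (shifted (<⇒≤ c<k) d<n))
    column-c : toggleColumn c ⟦ suc c , n ∣ c , suc d ⟧ ≡ ⟦ suc c , n ∣ suc c , suc d ⟧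
    column-c = toggleColumn-fromRows c<n
      (toggle₂-accept c<n (invertAt-shrinkˡ (m<n⇒m<1+n c<d)) (shifted ≤-refl d<n))
      (toggle₁-reject c<n (notICS₁₂₂ {i = c} {c} {d} ≤-refl (<⇒≤ c<d) d<n
                             (invertAt-on (interval-< (n<1+n c)))
                             (interval-< (n<1+n c))
                             (interval-∈ c<d (n<1+n d))))
    below-c : sweep 0 c ⟦ suc c , n ∣ suc c , suc d ⟧ ≡ ⟦ suc c , n ∣ suc c , suc d ⟧
    below-c = sweep-rejects 0 c
      (λ j _ j<c _ → notICS₂₂₂ {i = j} {c} {d} (<⇒≤ j<c) (<⇒≤ c<d) d<n
                       (invertAt-on (interval-< (m<n⇒m<1+n j<c)))
                       (invertAt-there (>⇒≢ j<c) (interval-< (n<1+n c)))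
                       (invertAt-there (>⇒≢ (<-trans j<c c<d)) (interval-∈ c<d (n<1+n d))))
      (λ j _ j<c _ → notICS₁₁₁ {i = j} {c} {suc c} (<⇒≤ j<c) (n≤1+n c) (≤-<-trans c<d d<n)
                       (invertAt-on (interval-< (m<n⇒m<1+n j<c)))
                       (invertAt-there (>⇒≢ j<c) (interval-< (n<1+n c)))
                       (invertAt-there (>⇒≢ (m<n⇒m<1+n j<c)) (interval-∈ ≤-refl (≤-<-trans c<d d<n))))
      (<⇒≤ c<n)

  Row-common-start : ∀ {c d} → c < d → d < n → Row ⟦ c , n ∣ c , d ⟧ ≡ ⟦ suc c , suc d ∣ 0 , suc d ⟧
  Row-common-start {c} {d} c<d d<n =
    trans (Row≡sweep _) (sweep-compose z≤n d<n above-d (sweep-through d z≤n (n<1+n d) (sweep-empty _ (suc d)) column-d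
                           (sweep-through c z≤n c<d inside column-c below-c)))
    where
    c<n : c < n
    c<n = <-trans c<d d<n
    above-d : sweep (suc d) n ⟦ c , n ∣ c , d ⟧ ≡ ⟦ c , suc d ∣ c , d ⟧
    above-d = sweep-moves (λ j → interval c j) (λ _ → interval c d) (suc d) n d<n ≤-refl
      (λ k d<k _ k<n → toggle₂-reject k<n (notICS₁₂₂ {i = c} {d} {k} (<⇒≤ c<d) (<⇒≤ d<k) k<n
                                             (interval-∈ ≤-refl (<-trans c<d (m<n⇒m<1+n d<k)))
                                             (invertAt-there (<⇒≢ d<k) (interval-≥ ≤-refl))
                                             (invertAt-on (interval-≥ (<⇒≤ d<k)))))
      (λ k d<k _ k<n → toggle₁-accept k<n (invertAt-shrinkʳ (<⇒≤ (<-trans c<d d<k))) (shifted ≤-refl (<⇒≤ d<k)))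
    column-d : toggleColumn d ⟦ c , suc d ∣ c , d ⟧ ≡ ⟦ c , suc d ∣ c , suc d ⟧
    column-d = toggleColumn-fromRows d<n
      (toggle₂-accept d<n (invertAt-extendʳ (<⇒≤ c<d)) (shifted ≤-refl ≤-refl))
      (toggle₁-reject d<n (notICS₁₁₂ {i = c} {d} {d} (<⇒≤ c<d) ≤-refl d<n
                             (invertAt-there (<⇒≢ c<d) (interval-∈ ≤-refl (m<n⇒m<1+n c<d)))
                             (invertAt-off (interval-∈ (<⇒≤ c<d) (n<1+n d)))
                             (interval-∈ (<⇒≤ c<d) (n<1+n d))))
    inside : sweep (suc c) d ⟦ c , suc d ∣ c , suc d ⟧ ≡ ⟦ c , suc d ∣ c , suc d ⟧
    inside = sweep-rejects (suc c) d
      (λ j c<j j<d _ → notICS₂₂₂ {i = c} {j} {d} (<⇒≤ c<j) (<⇒≤ j<d) d<n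
                         (invertAt-there (<⇒≢ c<j) (interval-∈ ≤-refl (m<n⇒m<1+n c<d)))
                         (invertAt-off (interval-∈ (<⇒≤ c<j) (m<n⇒m<1+n j<d)))
                         (invertAt-there (>⇒≢ j<d) (interval-∈ (<⇒≤ c<d) (n<1+n d))))
      (λ j c<j j<d _ → notICS₁₁₁ {i = c} {j} {d} (<⇒≤ c<j) (<⇒≤ j<d) d<n
                         (invertAt-there (<⇒≢ c<j) (interval-∈ ≤-refl (m<n⇒m<1+n c<d)))
                         (invertAt-off (interval-∈ (<⇒≤ c<j) (m<n⇒m<1+n j<d)))
                         (invertAt-there (>⇒≢ j<d) (interval-∈ (<⇒≤ c<d) (n<1+n d))))
      (<⇒≤ d<n)
    column-c : toggleColumn c ⟦ c , suc d ∣ c , suc d ⟧ ≡ ⟦ suc c , suc d ∣ c , suc d ⟧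
    column-c = toggleColumn-fromRows c<n
      (toggle₂-reject c<n (notICS₁₂₂ {i = c} {c} {d} ≤-refl (<⇒≤ c<d) d<n
                             (interval-∈ ≤-refl (m<n⇒m<1+n c<d))
                             (invertAt-off (interval-∈ ≤-refl (m<n⇒m<1+n c<d)))
                             (invertAt-there (>⇒≢ c<d) (interval-∈ (<⇒≤ c<d) (n<1+n d)))))
      (toggle₁-accept c<n (invertAt-shrinkˡ (m<n⇒m<1+n c<d)) (shifted (n≤1+n c) ≤-refl))
    below-c : sweep 0 c ⟦ suc c , suc d ∣ c , suc d ⟧ ≡ ⟦ suc c , suc d ∣ 0 , suc d ⟧
    below-c = sweep-moves (λ _ → interval (suc c) (suc d)) (λ j → interval j (suc d)) 0 c z≤n (<⇒≤ c<n)
      (λ k _ k<c k<n → toggle₂-accept k<n (invertAt-extendˡ (m<n⇒m<1+n (<-trans k<c c<d))) (shifted (<⇒≤ (m<n⇒m<1+n k<c)) ≤-refl))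
      (λ k _ k<c k<n → toggle₁-reject k<n (notICS₁₁₂ {i = k} {c} {d} (<⇒≤ k<c) (<⇒≤ c<d) d<n
                                             (invertAt-on (interval-< (m<n⇒m<1+n k<c)))
                                             (invertAt-there (>⇒≢ k<c) (interval-< (n<1+n c)))
                                             (interval-∈ (<⇒≤ (<-trans k<c c<d)) (n<1+n d))))

  Row-common-end : ∀ {c d} → c < d → d < n → Row ⟦ c , d ∣ 0 , d ⟧ ≡ ⟦ suc c , suc d ∣ 0 , 0 ⟧
  Row-common-end {c} {d} c<d d<n =
    trans (Row≡sweep _) (sweep-through d z≤n d<n above-d column-d
                           (sweep-compose z≤n c<d inside (sweep-through c z≤n (n<1+n c) (sweep-empty _ (suc c)) column-c below-c)))
    where
    c<n : c < n
    c<n = <-trans c<d d<n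
    above-d : sweep (suc d) n ⟦ c , d ∣ 0 , d ⟧ ≡ ⟦ c , d ∣ 0 , d ⟧
    above-d = sweep-rejects (suc d) n
      (λ j d<j _ j<n → notICS₁₂₂ {i = c} {d} {j} (<⇒≤ c<d) (<⇒≤ d<j) j<n
                         (interval-∈ ≤-refl c<d)
                         (invertAt-there (<⇒≢ d<j) (interval-≥ ≤-refl))
                         (invertAt-on (interval-≥ (<⇒≤ d<j))))
      (λ j d<j _ j<n → notICS₁₁₁ {i = c} {d} {j} (<⇒≤ c<d) (<⇒≤ d<j) j<n
                         (invertAt-there (<⇒≢ (<-trans c<d d<j)) (interval-∈ ≤-refl c<d))
                         (invertAt-there (<⇒≢ d<j) (interval-≥ ≤-refl))
                         (invertAt-on (interval-≥ (<⇒≤ d<j))))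
      ≤-refl
    column-d : toggleColumn d ⟦ c , d ∣ 0 , d ⟧ ≡ ⟦ c , suc d ∣ 0 , d ⟧
    column-d = toggleColumn-fromRows d<n
      (toggle₂-reject d<n (notICS₁₁₂ {i = c} {d} {d} (<⇒≤ c<d) ≤-refl d<n
                             (interval-∈ ≤-refl c<d)
                             (interval-≥ ≤-refl)
                             (invertAt-on (interval-≥ ≤-refl))))
      (toggle₁-accept d<n (invertAt-extendʳ (<⇒≤ c<d)) (shifted z≤n (n≤1+n d)))
    inside : sweep (suc c) d ⟦ c , suc d ∣ 0 , d ⟧ ≡ ⟦ c , suc d ∣ 0 , suc c ⟧
    inside = sweep-moves (λ _ → interval c (suc d)) (λ j → interval 0 j) (suc c) d c<d (<⇒≤ d<n)
      (λ k _ k<d k<n → toggle₂-accept k<n (invertAt-shrinkʳ z≤n) (shifted z≤n (<⇒≤ (m<n⇒m<1+n k<d))))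
      (λ k c<k k<d k<n → toggle₁-reject k<n (notICS₁₁₁ {i = c} {k} {d} (<⇒≤ c<k) (<⇒≤ k<d) d<n
                                               (invertAt-there (<⇒≢ c<k) (interval-∈ ≤-refl (m<n⇒m<1+n c<d)))
                                               (invertAt-off (interval-∈ (<⇒≤ c<k) (m<n⇒m<1+n k<d)))
                                               (invertAt-there (>⇒≢ k<d) (interval-∈ (<⇒≤ c<d) (n<1+n d)))))
    column-c : toggleColumn c ⟦ c , suc d ∣ 0 , suc c ⟧ ≡ ⟦ suc c , suc d ∣ 0 , c ⟧
    column-c = toggleColumn-fromRows c<n
      (toggle₂-accept c<n (invertAt-shrinkʳ z≤n) (row₂-left ≤-refl))
      (toggle₁-accept c<n (invertAt-shrinkˡ (m<n⇒m<1+n c<d)) (row₂-left (n≤1+n c)))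
    below-c : sweep 0 c ⟦ suc c , suc d ∣ 0 , c ⟧ ≡ ⟦ suc c , suc d ∣ 0 , 0 ⟧
    below-c = sweep-moves (λ _ → interval (suc c) (suc d)) (λ j → interval 0 j) 0 c z≤n (<⇒≤ c<n)
      (λ k _ k<c k<n → toggle₂-accept k<n (invertAt-shrinkʳ z≤n) (row₂-left (<⇒≤ (m<n⇒m<1+n k<c))))
      (λ k _ k<c k<n → toggle₁-reject k<n (notICS₁₁₁ {i = k} {c} {suc c} (<⇒≤ k<c) (n≤1+n c) (≤-<-trans c<d d<n)
                                             (invertAt-on (interval-< (m<n⇒m<1+n k<c)))
                                             (invertAt-there (>⇒≢ k<c) (interval-< (n<1+n c)))
                                             (invertAt-there (>⇒≢ (m<n⇒m<1+n k<c)) (interval-∈ ≤-refl (s≤s c<d)))))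

-- The orbit of [3 + p , 4 + q , r : ∅]

Row^-+ : ∀ {n} a b (I : Sub n) → Row^ (a + b) I ≡ Row^ a (Row^ b I)
Row^-+ zero    b I = refl
Row^-+ (suc a) b I = cong Row (Row^-+ a b I)

Row^-+′ : ∀ {n} a b (I : Sub n) → Row^ (a + b) I ≡ Row^ b (Row^ a I)
Row^-+′ a b I = trans (cong (λ m → Row^ m I) (+-comm a b)) (Row^-+ b a I)

Row^-periodic : ∀ {n P} {I : Sub n} → Row^ P I ≡ I → ∀ m → Row^ (m * P) I ≡ I
Row^-periodic         period zero    = refl
Row^-periodic {P = P} {I} period (suc m) = trans (Row^-+ P (m * P) I) (trans (cong (Row^ P) (Row^-periodic period m)) period)

Row^-% : ∀ {n P} .{{_ : NonZero P}} {I : Sub n} → Row^ P I ≡ I → ∀ k → Row^ (k % P) I ≡ Row^ k I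
Row^-% {P = P} {I} period k = begin
  Row^ (k % P) I                       ≡⟨ cong (Row^ (k % P)) (Row^-periodic period (k / P)) ⟨
  Row^ (k % P) (Row^ ((k / P) * P) I)  ≡⟨ Row^-+ (k % P) ((k / P) * P) I ⟨
  Row^ (k % P + (k / P) * P) I         ≡⟨ cong (λ m → Row^ m I) (m≡m%n+[m/n]*n k P) ⟨
  Row^ k I                             ∎
  where open ≡-Reasoning

<-witness : ∀ {a b} t → suc a + t ≡ b → a < b
<-witness {a} t refl = m≤m+n (suc a) t

Triple : Set
Triple = ℕ × ℕ × ℕ

sum₃ : Triple → ℕ
sum₃ (p , q , r) = p + q + r

rotate : Triple → Triple
rotate (p , q , r) = (r , p , q)

row₂-occupied : ∀ {n a b c d s₁ k} → c ≤ k → k < d → k < n → ⟦_,_∣_,_⟧ {n} a b c d ≢ fromRows n s₁ (interval 0 0)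
row₂-occupied {k = k} c≤k k<d k<n eq =
  contradiction (trans (sym (interval-∈ c≤k k<d)) (trans (fromRows-injective (fsuc fzero) eq k<n) (interval-empty z≤n k))) λ ()

<4+-cases : ∀ r {j} → 0 < j → j < 4 + r → (∃ λ k → k < r × j ≡ suc k) ⊎ j ≡ 1 + r ⊎ j ≡ 2 + r ⊎ j ≡ 3 + r
<4+-cases zero    {1} _ _ = inj₂ (inj₁ refl)
<4+-cases zero    {2} _ _ = inj₂ (inj₂ (inj₁ refl))
<4+-cases zero    {3} _ _ = inj₂ (inj₂ (inj₂ refl))
<4+-cases zero    {suc (suc (suc (suc _)))} _ (s≤s (s≤s (s≤s (s≤s ()))))
<4+-cases (suc r) {1} _ _ = inj₁ (0 , z<s , refl)
<4+-cases (suc r) {suc (suc j)} _ (s≤s j<4+r) with <4+-cases r {suc j} z<s j<4+r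
... | inj₁ (k , k<r , refl) = inj₁ (suc k , s≤s k<r , refl)
... | inj₂ (inj₁ refl) = inj₂ (inj₁ refl)
... | inj₂ (inj₂ (inj₁ refl)) = inj₂ (inj₂ (inj₁ refl))
... | inj₂ (inj₂ (inj₂ refl)) = inj₂ (inj₂ (inj₂ refl))

-- n is kept a variable: for n = 7 + N, conversion checking would unfold Row into
-- exponentially large terms.
module _ {n : ℕ} (p q r : ℕ) (size : 7 + (p + q + r) ≡ n) where

  private
    end : ℕ
    end = (3 + p) + (4 + q)

    n≡r+end : n ≡ r + end
    n≡r+end = trans (sym size) (solve 3 (λ p q r → con 7 :+ (p :+ q :+ r) := r :+ ((con 3 :+ p) :+ (con 4 :+ q))) refl p q r)

    start<end : 3 + p < end
    start<end = m<m+n (3 + p) z<s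

    Row^[1+k] : ∀ k → k < r → Row^ {n} (suc k) ⟦ 3 + p , end ∣ 0 , 0 ⟧ ≡ ⟦ k + (4 + p) , k + suc end ∣ k , k + (4 + p) ⟧
    Row^[1+k] zero    0<r = Row-lower {n} start<end (subst (end <_) (sym n≡r+end) (m<n+m end 0<r))
    Row^[1+k] (suc k) k<r = trans (cong (Row {n}) (Row^[1+k] k (<-trans (n<1+n k) k<r)))
      (Row-staircase {n} (m<m+n k z<s) (+-monoʳ-< k (s≤s start<end))
        (subst₂ _<_ (sym (+-suc k end)) (sym n≡r+end) (+-monoˡ-< end k<r)))

    [r+4+p]+2<n : 2 + (r + (4 + p)) < n
    [r+4+p]+2<n = <-witness q (trans (solve 3 (λ p q r → con 3 :+ (r :+ (con 4 :+ p)) :+ q := con 7 :+ (p :+ q :+ r)) refl p q r) size)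

    1+r<n : suc r < n
    1+r<n = ≤-<-trans (s≤s (≤-trans (m≤m+n r (4 + p)) (n≤1+n _))) [r+4+p]+2<n

    Row^[1+r] : Row^ {n} (suc r) ⟦ 3 + p , end ∣ 0 , 0 ⟧ ≡ ⟦ 0 , 0 ∣ r , r + (4 + p) ⟧
    Row^[1+r] = from r refl
      where
      from : ∀ r′ → r′ ≡ r → Row^ {n} (suc r′) ⟦ 3 + p , end ∣ 0 , 0 ⟧ ≡ ⟦ 0 , 0 ∣ r′ , r′ + (4 + p) ⟧
      from zero    refl = subst (λ e → Row {n} ⟦ 3 + p , e ∣ 0 , 0 ⟧ ≡ ⟦ 0 , 0 ∣ 0 , 4 + p ⟧) n≡r+end
        (Row-lower-end {n} (subst (3 + p <_) (sym n≡r+end) start<end))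
      from (suc r′) refl = trans (cong (Row {n}) (Row^[1+k] r′ (n<1+n r′)))
        (subst (λ e → Row {n} ⟦ r′ + (4 + p) , e ∣ r′ , r′ + (4 + p) ⟧ ≡ ⟦ 0 , 0 ∣ suc r′ , suc r′ + (4 + p) ⟧) (sym r′+suc-end≡n)
          (Row-staircase-end {n} (m<m+n r′ z<s) (subst (r′ + (4 + p) <_) r′+suc-end≡n (+-monoʳ-< r′ (s≤s start<end)))))
        where
        r′+suc-end≡n : r′ + suc end ≡ n
        r′+suc-end≡n = trans (+-suc r′ end) (sym n≡r+end)

    Row^[2+r] : Row^ {n} (2 + r) ⟦ 3 + p , end ∣ 0 , 0 ⟧ ≡ ⟦ suc r , n ∣ suc r , suc (r + (4 + p)) ⟧
    Row^[2+r] = trans (cong (Row {n}) Row^[1+r]) (Row-upper {n} (m<m+n r z<s) (<-trans (n<1+n _) (<-trans (n<1+n _) [r+4+p]+2<n)))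

    Row^[3+r] : Row^ {n} (3 + r) ⟦ 3 + p , end ∣ 0 , 0 ⟧ ≡ ⟦ 2 + r , 2 + (r + (4 + p)) ∣ 0 , 2 + (r + (4 + p)) ⟧
    Row^[3+r] = trans (cong (Row {n}) Row^[2+r]) (Row-common-start {n} (s≤s (m<m+n r z<s)) (<-trans (n<1+n _) [r+4+p]+2<n))

  Row^-rotate : Row^ {n} (4 + r) ⟦ 3 + p , (3 + p) + (4 + q) ∣ 0 , 0 ⟧ ≡ ⟦ 3 + r , (3 + r) + (4 + p) ∣ 0 , 0 ⟧
  Row^-rotate = trans (cong (Row {n}) Row^[3+r]) (Row-common-end {n} (s≤s (s≤s (m<m+n r z<s))) [r+4+p]+2<n)

  Row^-row₂-occupied : ∀ {j} → 0 < j → j < 4 + r →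
    ∀ {s₁} → Row^ {n} j ⟦ 3 + p , (3 + p) + (4 + q) ∣ 0 , 0 ⟧ ≢ fromRows n s₁ (interval 0 0)
  Row^-row₂-occupied 0<j j<4+r eq with <4+-cases r 0<j j<4+r
  ... | inj₁ (k , k<r , refl) = row₂-occupied ≤-refl (m<m+n k z<s) (<-trans k<r (<-trans (n<1+n r) 1+r<n)) (trans (sym (Row^[1+k] k k<r)) eq)
  ... | inj₂ (inj₁ refl) = row₂-occupied ≤-refl (m<m+n r z<s) (<-trans (n<1+n r) 1+r<n) (trans (sym Row^[1+r]) eq)
  ... | inj₂ (inj₂ (inj₁ refl)) = row₂-occupied ≤-refl (s≤s (m<m+n r z<s)) 1+r<n (trans (sym Row^[2+r]) eq)
  ... | inj₂ (inj₂ (inj₂ refl)) = row₂-occupied z≤n z<s (≤-<-trans z≤n 1+r<n) (trans (sym Row^[3+r]) eq)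

target : ∀ n → Triple → Sub n
target n (p , q , _) = bia∅ n (3 + p) (4 + q)

Fits : ℕ → Triple → Set
Fits n t = 7 + sum₃ t ≡ n

target≡⟦⟧ : ∀ n p q r → target n (p , q , r) ≡ ⟦ 3 + p , (3 + p) + (4 + q) ∣ 0 , 0 ⟧
target≡⟦⟧ n p q r = bia∅≡fromRows n (3 + p) (4 + q)

target-end≤ : ∀ {n} p q r → Fits n (p , q , r) → (3 + p) + (4 + q) ≤ n
target-end≤ p q r refl =
  subst ((3 + p) + (4 + q) ≤_) (solve 3 (λ p q r → (con 3 :+ p) :+ (con 4 :+ q) :+ r := con 7 :+ (p :+ q :+ r)) refl p q r) (m≤m+n _ r)

target-injective : ∀ {n} t t′ → Fits n t → Fits n t′ → target n t ≡ target n t′ → t ≡ t′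
target-injective {n} (p , q , r) (p′ , q′ , r′) fits fits′ eq
  with interval-injective (m<m+n (3 + p) z<s) (m<m+n (3 + p′) z<s) (target-end≤ p q r fits) (target-end≤ p′ q′ r′ fits′)
         (fromRows-injective fzero (trans (sym (target≡⟦⟧ n p q r)) (trans eq (target≡⟦⟧ n p′ q′ r′))))
... | refl , end≡end′ with +-cancelˡ-≡ (3 + p) (4 + q) (4 + q′) end≡end′
... | refl = cong (λ r → p , q , r) (+-cancelˡ-≡ (7 + (p + q)) r r′ (trans fits (sym fits′)))

stride : Triple → ℕ
stride (_ , _ , r) = 4 + r

period : Triple → ℕ
period t = stride t + (stride (rotate t) + stride (rotate (rotate t)))

period≡ : ∀ {n} t → Fits n t → period t ≡ n + 5
period≡ (p , q , r) refl = solve 3 (λ p q r → (con 4 :+ r) :+ ((con 4 :+ q) :+ (con 4 :+ p)) := con 7 :+ (p :+ q :+ r) :+ con 5) refl p q r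

sum₃-rotate : ∀ t → sum₃ (rotate t) ≡ sum₃ t
sum₃-rotate (p , q , r) = solve 3 (λ p q r → r :+ p :+ q := p :+ q :+ r) refl p q r

Fits-rotate : ∀ {n} t → Fits n t → Fits n (rotate t)
Fits-rotate t fits = trans (cong (7 +_) (sum₃-rotate t)) fits

Row^-target-rotate : ∀ {n} t → Fits n t → Row^ (stride t) (target n t) ≡ target n (rotate t)
Row^-target-rotate {n} (p , q , r) fits = begin
  Row^ (4 + r) (target n (p , q , r))                  ≡⟨ cong (Row^ (4 + r)) (target≡⟦⟧ n p q r) ⟩
  Row^ (4 + r) ⟦ 3 + p , (3 + p) + (4 + q) ∣ 0 , 0 ⟧  ≡⟨ Row^-rotate p q r fits ⟩
  ⟦ 3 + r , (3 + r) + (4 + p) ∣ 0 , 0 ⟧                ≡⟨ target≡⟦⟧ n r p q ⟨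
  target n (r , p , q)                                 ∎
  where open ≡-Reasoning

Row^-target-period : ∀ {n} t → Fits n t → Row^ (period t) (target n t) ≡ target n t
Row^-target-period {n} t@(_ , _ , _) fits = begin
  Row^ (period t) (target n t)
    ≡⟨ Row^-+′ (stride t) _ _ ⟩
  Row^ (stride (rotate t) + stride (rotate (rotate t))) (Row^ (stride t) (target n t))
    ≡⟨ Row^-+′ (stride (rotate t)) _ _ ⟩
  Row^ (stride (rotate (rotate t))) (Row^ (stride (rotate t)) (Row^ (stride t) (target n t)))
    ≡⟨ cong (Row^ (stride (rotate (rotate t))) ∘ Row^ (stride (rotate t))) (Row^-target-rotate t fits) ⟩
  Row^ (stride (rotate (rotate t))) (Row^ (stride (rotate t)) (target n (rotate t)))
    ≡⟨ cong (Row^ (stride (rotate (rotate t)))) (Row^-target-rotate (rotate t) (Fits-rotate t fits)) ⟩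
  Row^ (stride (rotate (rotate t))) (target n (rotate (rotate t)))
    ≡⟨ Row^-target-rotate (rotate (rotate t)) (Fits-rotate (rotate t) (Fits-rotate t fits)) ⟩
  target n t
    ∎
  where open ≡-Reasoning

Row^-target-within : ∀ {n k} t t′ → Fits n t → Fits n t′ → k < stride t → Row^ k (target n t) ≡ target n t′ → k ≡ 0 × t′ ≡ t
Row^-target-within {k = zero}  t t′ fits fits′ _ eq = refl , sym (target-injective t t′ fits fits′ eq)
Row^-target-within {n} {suc k} (p , q , r) (p′ , q′ , r′) fits _ k<s eq = contradiction
  (trans (sym (cong (Row^ (suc k)) (target≡⟦⟧ n p q r))) (trans eq (target≡⟦⟧ n p′ q′ r′)))
  (Row^-row₂-occupied p q r fits z<s k<s)

Row^-target-beyond : ∀ {n k} t → Fits n t → stride t ≤ k → Row^ k (target n t) ≡ Row^ (k ∸ stride t) (target n (rotate t))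
Row^-target-beyond {n} {k} t fits s≤k = begin
  Row^ k (target n t)                                  ≡⟨ cong (λ m → Row^ m (target n t)) (m∸n+n≡m s≤k) ⟨
  Row^ (k ∸ stride t + stride t) (target n t)           ≡⟨ Row^-+ (k ∸ stride t) (stride t) (target n t) ⟩
  Row^ (k ∸ stride t) (Row^ (stride t) (target n t))    ≡⟨ cong (Row^ (k ∸ stride t)) (Row^-target-rotate t fits) ⟩
  Row^ (k ∸ stride t) (target n (rotate t))             ∎
  where open ≡-Reasoning

Row^-target-hits : ∀ {n k} t t′ → Fits n t → Fits n t′ → k < period t → Row^ k (target n t) ≡ target n t′ →
  (k ≡ 0 × t′ ≡ t) ⊎ t′ ≡ rotate t ⊎ t′ ≡ rotate (rotate t)
Row^-target-hits {n} {k} t t′ fits fits′ k<P eq with k <? stride t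
... | yes k<s = inj₁ (Row^-target-within t t′ fits fits′ k<s eq)
... | no k≮s with k ∸ stride t <? stride (rotate t)
...   | yes k₁<s₁ = inj₂ (inj₁ (proj₂ (Row^-target-within (rotate t) t′ fits₁ fits′ k₁<s₁ eq₁)))
  where
  fits₁ : Fits n (rotate t)
  fits₁ = Fits-rotate t fits
  eq₁ : Row^ (k ∸ stride t) (target n (rotate t)) ≡ target n t′
  eq₁ = trans (sym (Row^-target-beyond t fits (≮⇒≥ k≮s))) eq
...   | no k₁≮s₁ = inj₂ (inj₂ (proj₂ (Row^-target-within (rotate (rotate t)) t′ fits₂ fits′ k₂<s₂ eq₂)))
  where
  fits₁ : Fits n (rotate t)
  fits₁ = Fits-rotate t fits
  fits₂ : Fits n (rotate (rotate t))
  fits₂ = Fits-rotate (rotate t) fits₁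
  eq₂ : Row^ (k ∸ stride t ∸ stride (rotate t)) (target n (rotate (rotate t))) ≡ target n t′
  eq₂ = trans (sym (Row^-target-beyond (rotate t) fits₁ (≮⇒≥ k₁≮s₁))) (trans (sym (Row^-target-beyond t fits (≮⇒≥ k≮s))) eq)
  k₂<s₂ : k ∸ stride t ∸ stride (rotate t) < stride (rotate (rotate t))
  k₂<s₂ = subst (k ∸ stride t ∸ stride (rotate t) <_) (m+n∸m≡n (stride (rotate t)) _)
            (∸-monoˡ-< (subst (k ∸ stride t <_) (m+n∸m≡n (stride t) _) (∸-monoˡ-< k<P (≮⇒≥ k≮s))) (≮⇒≥ k₁≮s₁))

rotations : Triple → List Triple
rotations t = t ∷ rotate t ∷ rotate (rotate t) ∷ []

InOrbit-target⇒∈-rotations : ∀ {n} t t′ → Fits n t → Fits n t′ → InOrbit (target n t) (target n t′) → t′ ∈ rotations t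
InOrbit-target⇒∈-rotations {n} t@(_ , _ , _) t′ fits fits′ (k , eq) =
  hit⇒∈ (Row^-target-hits t t′ fits fits′ (m%n<n k (period t)) (trans (Row^-% (Row^-target-period t fits) k) eq))
  where
  hit⇒∈ : ∀ {k′} → (k′ ≡ 0 × t′ ≡ t) ⊎ t′ ≡ rotate t ⊎ t′ ≡ rotate (rotate t) → t′ ∈ rotations t
  hit⇒∈ (inj₁ (_ , t′≡t)) = here t′≡t
  hit⇒∈ (inj₂ (inj₁ t′≡rt)) = there (here t′≡rt)
  hit⇒∈ (inj₂ (inj₂ t′≡rrt)) = there (there (here t′≡rrt))

∈-rotations⇒InOrbit-target : ∀ {n} t t′ → Fits n t → t′ ∈ rotations t → InOrbit (target n t) (target n t′)
∈-rotations⇒InOrbit-target t _ fits (here refl) = 0 , refl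
∈-rotations⇒InOrbit-target t _ fits (there (here refl)) = stride t , Row^-target-rotate t fits
∈-rotations⇒InOrbit-target t _ fits (there (there (here refl))) =
  stride t + stride (rotate t) ,
  trans (Row^-+′ (stride t) (stride (rotate t)) _)
    (trans (cong (Row^ (stride (rotate t))) (Row^-target-rotate t fits)) (Row^-target-rotate (rotate t) (Fits-rotate t fits)))

target-OrbitSize : ∀ {n} t → Fits n t → t ≢ rotate t → OrbitSize (target n t) (n + 5)
target-OrbitSize {n} t@(_ , _ , _) fits non-fixed =
  <-≤-trans z<s (m≤n+m 5 n) ,
  subst (λ m → Row^ m (target n t) ≡ target n t) (period≡ t fits) (Row^-target-period t fits) ,
  λ k 0<k k<n+5 eq → minimal k 0<k (Row^-target-hits t t fits fits (subst (k <_) (sym (period≡ t fits)) k<n+5) eq)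
  where
  minimal : ∀ k → 0 < k → (k ≡ 0 × t ≡ t) ⊎ t ≡ rotate t ⊎ t ≡ rotate (rotate t) → ⊥
  minimal _ 0<k (inj₁ (refl , _)) = <-irrefl refl 0<k
  minimal _ _ (inj₂ (inj₁ t≡rt)) = non-fixed t≡rt
  minimal _ _ (inj₂ (inj₂ t≡rrt)) = non-fixed (sym (cong rotate t≡rrt))

diagonal : ℕ → Triple
diagonal s = (s , s , s)

diagonal-OrbitSize : ∀ {n} s → Fits n (diagonal s) → OrbitSize (target n (diagonal s)) (4 + s)
diagonal-OrbitSize s fits =
  z<s , Row^-target-rotate (diagonal s) fits ,
  λ k 0<k k<4+s eq → <-irrefl (sym (proj₁ (Row^-target-within (diagonal s) (diagonal s) fits fits k<4+s eq))) 0<k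

-- Canonical triples

-- Each rotation class of a non-constant triple has exactly one canonical member.
IsCanonical : Triple → Set
IsCanonical (p , q , r) = p ≤ q × p < r

bump : Triple → Triple
bump (p , q , r) = (suc p , suc q , suc r)

zeroHeaded : ℕ → ℕ → List Triple
zeroHeaded q zero    = []
zeroHeaded q (suc r) = (0 , q , suc r) ∷ zeroHeaded (suc q) r

mutual
  canonical : ℕ → List Triple
  canonical N = zeroHeaded 0 N ++ map bump (canonical∸3 N)

  canonical∸3 : ℕ → List Triple
  canonical∸3 (suc (suc (suc N))) = canonical N
  canonical∸3 _                   = []

sum₃-bump : ∀ t → sum₃ (bump t) ≡ 3 + sum₃ t
sum₃-bump (p , q , r) = solve 3 (λ p q r → (con 1 :+ p) :+ (con 1 :+ q) :+ (con 1 :+ r) := con 3 :+ (p :+ q :+ r)) refl p q r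

zeroHeaded-sound : ∀ q r {t} → t ∈ zeroHeaded q r → IsCanonical t × sum₃ t ≡ q + r
zeroHeaded-sound q (suc r) (here refl) = (z≤n , z<s) , refl
zeroHeaded-sound q (suc r) (there t∈) with zeroHeaded-sound (suc q) r t∈
... | canonical-t , sum = canonical-t , trans sum (sym (+-suc q r))

mutual
  canonical-sound : ∀ N {t} → t ∈ canonical N → IsCanonical t × sum₃ t ≡ N
  canonical-sound N t∈ with ∈-++⁻ (zeroHeaded 0 N) t∈
  ... | inj₁ t∈zeroHeaded = zeroHeaded-sound 0 N t∈zeroHeaded
  ... | inj₂ t∈bumped with ∈-map⁻ bump t∈bumped
  ... | c , c∈ , refl = canonical∸3-sound N c∈

  canonical∸3-sound : ∀ N {c} → c ∈ canonical∸3 N → IsCanonical (bump c) × sum₃ (bump c) ≡ N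
  canonical∸3-sound (suc (suc (suc N))) {c@(_ , _ , _)} c∈ with canonical-sound N c∈
  ... | (p≤q , p<r) , sum = (s≤s p≤q , s≤s p<r) , trans (sum₃-bump c) (cong (3 +_) sum)

∈-zeroHeaded : ∀ q k r → (0 , q + k , suc r) ∈ zeroHeaded q (k + suc r)
∈-zeroHeaded q zero    r = here (cong (λ x → 0 , x , suc r) (+-identityʳ q))
∈-zeroHeaded q (suc k) r = there (subst (λ x → (0 , x , suc r) ∈ zeroHeaded (suc q) (k + suc r)) (sym (+-suc q k)) (∈-zeroHeaded (suc q) k r))

∈-canonical : ∀ t → IsCanonical t → t ∈ canonical (sum₃ t)
∈-canonical (zero , q , suc r) _ = ∈-++⁺ˡ (∈-zeroHeaded 0 q r)
∈-canonical t@(suc p , suc q , suc r) (s≤s p≤q , s≤s p<r) = ∈-++⁺ʳ (zeroHeaded 0 (sum₃ t))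
  (∈-map⁺ bump (subst (λ N → (p , q , r) ∈ canonical∸3 N) (sym (sum₃-bump (p , q , r))) (∈-canonical (p , q , r) (p≤q , p<r))))

zeroHeaded-unique : ∀ q r → Unique (zeroHeaded q r)
zeroHeaded-unique q zero    = []
zeroHeaded-unique q (suc r) = All.tabulate (λ t∈ → λ { refl → <-irrefl refl (later t∈) }) ∷ zeroHeaded-unique (suc q) r
  where
  later : ∀ {q r p′ q′ r′} → (p′ , q′ , r′) ∈ zeroHeaded q r → q ≤ q′
  later {r = suc r} (here refl) = ≤-refl
  later {r = suc r} (there t∈) = <⇒≤ (later t∈)

mutual
  canonical-unique : ∀ N → Unique (canonical N)
  canonical-unique N = Unique.++⁺ (zeroHeaded-unique 0 N) (Unique.map⁺ bump-injective (canonical∸3-unique N)) disjoint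
    where
    head≡0 : ∀ {q r t} → t ∈ zeroHeaded q r → proj₁ t ≡ 0
    head≡0 {r = suc r} (here refl) = refl
    head≡0 {r = suc r} (there t∈) = head≡0 t∈
    disjoint : ∀ {t} → ¬ (t ∈ zeroHeaded 0 N × t ∈ map bump (canonical∸3 N))
    disjoint (t∈zeroHeaded , t∈bumped) with ∈-map⁻ bump t∈bumped
    ... | (_ , _ , _) , _ , refl with head≡0 t∈zeroHeaded
    ... | ()
    bump-injective : ∀ {t t′} → bump t ≡ bump t′ → t ≡ t′
    bump-injective {_ , _ , _} {_ , _ , _} refl = refl

  canonical∸3-unique : ∀ N → Unique (canonical∸3 N)
  canonical∸3-unique (suc (suc (suc N))) = canonical-unique N
  canonical∸3-unique 0 = []
  canonical∸3-unique 1 = []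
  canonical∸3-unique 2 = []

length-zeroHeaded : ∀ q r → length (zeroHeaded q r) ≡ r
length-zeroHeaded q zero    = refl
length-zeroHeaded q (suc r) = cong suc (length-zeroHeaded (suc q) r)

length-canonical-+3 : ∀ N → length (canonical (3 + N)) ≡ (3 + N) + length (canonical N)
length-canonical-+3 N = begin
  length (zeroHeaded 0 (3 + N) ++ map bump (canonical N))        ≡⟨ length-++ (zeroHeaded 0 (3 + N)) ⟩
  length (zeroHeaded 0 (3 + N)) + length (map bump (canonical N)) ≡⟨ cong₂ _+_ (length-zeroHeaded 0 (3 + N)) (length-map bump (canonical N)) ⟩
  (3 + N) + length (canonical N)                                  ∎
  where open ≡-Reasoning

C2-suc : ∀ m → suc m C 2 ≡ m + m C 2
C2-suc m = trans (sym (nCk+nC[k+1]≡[n+1]C[k+1] m 1)) (cong (_+ m C 2) (nC1≡n m))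

3*length-canonical : ∀ N → N % 3 ≢ 0 → 3 * length (canonical N) ≡ (2 + N) C 2
3*length-canonical 0 N%3≢0 = contradiction refl N%3≢0
3*length-canonical 1 _ = refl
3*length-canonical 2 _ = refl
3*length-canonical (suc (suc (suc N))) N%3≢0 = begin
  3 * length (canonical (3 + N))
    ≡⟨ cong (3 *_) (length-canonical-+3 N) ⟩
  3 * ((3 + N) + length (canonical N))
    ≡⟨ solve 2 (λ N L → con 3 :* ((con 3 :+ N) :+ L) := (con 4 :+ N) :+ ((con 3 :+ N) :+ ((con 2 :+ N) :+ con 3 :* L))) refl N _ ⟩
  (4 + N) + ((3 + N) + ((2 + N) + 3 * length (canonical N)))
    ≡⟨ cong (λ c → (4 + N) + ((3 + N) + ((2 + N) + c))) (3*length-canonical N N%3≢0) ⟩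
  (4 + N) + ((3 + N) + ((2 + N) + (2 + N) C 2))
    ≡⟨ cong (λ c → (4 + N) + ((3 + N) + c)) (C2-suc (2 + N)) ⟨
  (4 + N) + ((3 + N) + (3 + N) C 2)
    ≡⟨ cong ((4 + N) +_) (C2-suc (3 + N)) ⟨
  (4 + N) + (4 + N) C 2
    ≡⟨ C2-suc (4 + N) ⟨
  (5 + N) C 2
    ∎
  where open ≡-Reasoning

6*length-canonical : ∀ N → N % 3 ≡ 0 → 6 * length (canonical N) ≡ (3 + N) * N
6*length-canonical 0 _ = refl
6*length-canonical 1 ()
6*length-canonical 2 ()
6*length-canonical (suc (suc (suc N))) N%3≡0 = begin
  6 * length (canonical (3 + N))        ≡⟨ cong (6 *_) (length-canonical-+3 N) ⟩
  6 * ((3 + N) + length (canonical N))  ≡⟨ *-distribˡ-+ 6 (3 + N) _ ⟩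
  6 * (3 + N) + 6 * length (canonical N) ≡⟨ cong (6 * (3 + N) +_) (6*length-canonical N N%3≡0) ⟩
  6 * (3 + N) + (3 + N) * N             ≡⟨ solve 1 (λ N → con 6 :* (con 3 :+ N) :+ (con 3 :+ N) :* N := (con 6 :+ N) :* (con 3 :+ N)) refl N ⟩
  (6 + N) * (3 + N)                     ∎
  where open ≡-Reasoning

canonical-representative : ∀ t → (∃ λ s → t ≡ diagonal s) ⊎ (∃ λ c → IsCanonical c × t ∈ rotations c)
canonical-representative (p , q , r) with q <? p
... | yes q<p with q ≤? r
...   | yes q≤r = inj₂ ((q , r , p) , (q≤r , q<p) , there (here refl))
...   | no q≰r = inj₂ ((r , p , q) , (<⇒≤ (<-trans r<q q<p) , r<q) , there (there (here refl)))
  where r<q = ≰⇒> q≰r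
canonical-representative (p , q , r) | no q≮p with <-cmp p r
... | tri< p<r _ _ = inj₂ ((p , q , r) , (≮⇒≥ q≮p , p<r) , here refl)
... | tri> _ _ r<p = inj₂ ((r , p , q) , (<⇒≤ r<p , <-≤-trans r<p (≮⇒≥ q≮p)) , there (there (here refl)))
... | tri≈ _ refl _ with p <? q
...   | yes p<q = inj₂ ((p , p , q) , (≤-refl , p<q) , there (there (here refl)))
...   | no p≮q = inj₁ (p , cong (λ x → p , x , p) (sym (≤-antisym (≮⇒≥ q≮p) (≮⇒≥ p≮q))))

canonical-rotation-unique : ∀ {c c′} → IsCanonical c → IsCanonical c′ → c′ ∈ rotations c → c′ ≡ c
canonical-rotation-unique _ _ (here c′≡c) = c′≡c
canonical-rotation-unique (_ , p<r) (r≤p , _) (there (here refl)) = contradiction r≤p (<⇒≱ p<r)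
canonical-rotation-unique (p≤q , _) (_ , q<p) (there (there (here refl))) = contradiction p≤q (<⇒≱ q<p)

canonical-non-fixed : ∀ {c} → IsCanonical c → c ≢ rotate c
canonical-non-fixed (_ , p<r) refl = <-irrefl refl p<r

canonical-non-diagonal : ∀ {c} s → IsCanonical c → c ≢ diagonal s
canonical-non-diagonal s (_ , p<r) refl = <-irrefl refl p<r

∈-rotations-diagonal : ∀ {t} s → t ∈ rotations (diagonal s) → t ≡ diagonal s
∈-rotations-diagonal s (here t≡d) = t≡d
∈-rotations-diagonal s (there (here t≡d)) = t≡d
∈-rotations-diagonal s (there (there (here t≡d))) = t≡d

diagonal-∈-rotations : ∀ {t} s → diagonal s ∈ rotations t → t ≡ diagonal s
diagonal-∈-rotations {_ , _ , _} s (here refl) = refl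
diagonal-∈-rotations {_ , _ , _} s (there (here refl)) = refl
diagonal-∈-rotations {_ , _ , _} s (there (there (here refl))) = refl

sum₃-∈-rotations : ∀ {c t} → t ∈ rotations c → sum₃ t ≡ sum₃ c
sum₃-∈-rotations (here refl) = refl
sum₃-∈-rotations {c} (there (here refl)) = sum₃-rotate c
sum₃-∈-rotations {c} (there (there (here refl))) = trans (sum₃-rotate (rotate c)) (sum₃-rotate c)

sum₃-diagonal : ∀ s → sum₃ (diagonal s) ≡ s * 3
sum₃-diagonal s = solve 1 (λ s → s :+ s :+ s := s :* con 3) refl s

-- The collections of orbits

Unique⇒lookup-injective : ∀ {A : Set} {xs : List A} → Unique xs → ∀ {i j} → List.lookup xs i ≡ List.lookup xs j → i ≡ j
Unique⇒lookup-injective (x∉ ∷ _)      {fzero}  {fzero}  _  = refl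
Unique⇒lookup-injective (x∉ ∷ _)      {fzero}  {fsuc j} eq = contradiction eq (All.lookup x∉ (∈-lookup j))
Unique⇒lookup-injective (x∉ ∷ _)      {fsuc i} {fzero}  eq = contradiction (sym eq) (All.lookup x∉ (∈-lookup i))
Unique⇒lookup-injective (_ ∷ unique) {fsuc i} {fsuc j} eq = cong fsuc (Unique⇒lookup-injective unique eq)

targets : ∀ n (ts : List Triple) → Vec (Sub n) (length ts)
targets n []       = []
targets n (t ∷ ts) = target n t ∷ targets n ts

lookup-targets : ∀ {n} ts i → lookup (targets n ts) i ≡ target n (List.lookup ts i)
lookup-targets (t ∷ ts) fzero    = refl
lookup-targets (t ∷ ts) (fsuc i) = lookup-targets ts i

target-isICS : ∀ {n} t → IsICS (target n t)
target-isICS {n} (p , q , r) =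
  subst (IsICS {n}) (sym (target≡⟦⟧ n p q r)) (intervals-isICS {n} {3 + p} {(3 + p) + (4 + q)} {0} {0} (row₂-empty z≤n))

DistinctOrbits-∷ : ∀ {n m} {I : Sub n} {reps : Vec (Sub n) m} → IsICS I →
  (∀ r → ¬ InOrbit I (lookup reps r)) → (∀ r → ¬ InOrbit (lookup reps r) I) →
  DistinctOrbits reps → DistinctOrbits (I ∷ reps)
DistinctOrbits-∷ {I = I} {reps} ics-I I↛ ↛I (ics , distinct) = all-ics , all-distinct
  where
  all-ics : ∀ r → IsICS (lookup (I ∷ reps) r)
  all-ics fzero    = ics-I
  all-ics (fsuc r) = ics r
  all-distinct : ∀ r r′ → r ≢ r′ → ¬ InOrbit (lookup (I ∷ reps) r) (lookup (I ∷ reps) r′)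
  all-distinct fzero    fzero     r≢r′ = contradiction refl r≢r′
  all-distinct fzero    (fsuc r′) _    = I↛ r′
  all-distinct (fsuc r) fzero     _    = ↛I r
  all-distinct (fsuc r) (fsuc r′) r≢r′ = distinct r r′ (r≢r′ ∘ cong fsuc)

-- For x = 4 + p and y = 4 + q, the set [x - 1 , y , n + 1 - x - y : ∅] is target n (p , q , n - 7 - p - q).
CoversTargets-intro : ∀ {n m} (reps : Vec (Sub n) m) →
  (∀ t → Fits n t → Σ (Fin m) λ r → InOrbit (lookup reps r) (target n t)) → CoversTargets reps
CoversTargets-intro {n} reps covers (suc (suc (suc (suc p)))) (suc (suc (suc (suc q)))) (s≤s (s≤s (s≤s (s≤s _)))) (s≤s (s≤s (s≤s (s≤s _)))) x+y≤n+1 =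
  covers (p , q , n ∸ (7 + (p + q))) (m+[n∸m]≡n 7+p+q≤n)
  where
  7+p+q≤n : 7 + (p + q) ≤ n
  7+p+q≤n = ≤-pred (subst₂ _≤_ (solve 2 (λ p q → (con 4 :+ p) :+ (con 4 :+ q) := con 8 :+ (p :+ q)) refl p q) (+-comm n 1) x+y≤n+1)

diagonal-Fits-unique : ∀ {n s s′} → Fits n (diagonal s) → Fits n (diagonal s′) → s ≡ s′
diagonal-Fits-unique {s = s} {s′} fits fits′ =
  *-cancelʳ-≡ s s′ 3 (trans (sym (sum₃-diagonal s)) (trans (+-cancelˡ-≡ 7 _ _ (trans fits (sym fits′))) (sum₃-diagonal s′)))

[7+N]%3≡1⇔N%3≡0 : ∀ N → (7 + N) % 3 ≡ 1 ⇔ N % 3 ≡ 0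
[7+N]%3≡1⇔N%3≡0 0 = mk⇔ (λ _ → refl) (λ _ → refl)
[7+N]%3≡1⇔N%3≡0 1 = mk⇔ (λ ()) (λ ())
[7+N]%3≡1⇔N%3≡0 2 = mk⇔ (λ ()) (λ ())
[7+N]%3≡1⇔N%3≡0 (suc (suc (suc N))) = [7+N]%3≡1⇔N%3≡0 N

module _ {n N : ℕ} (size : 7 + N ≡ n) where

  private
    n%3≡1⇔N%3≡0 : n % 3 ≡ 1 ⇔ N % 3 ≡ 0
    n%3≡1⇔N%3≡0 = subst (λ m → m % 3 ≡ 1 ⇔ N % 3 ≡ 0) size ([7+N]%3≡1⇔N%3≡0 N)

    diagonal-Fits⇒N%3≡0 : ∀ {s} → Fits n (diagonal s) → N % 3 ≡ 0
    diagonal-Fits⇒N%3≡0 {s} fits = subst (λ m → m % 3 ≡ 0)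
      (+-cancelˡ-≡ 7 _ _ (trans (cong (7 +_) (sym (sum₃-diagonal s))) (trans fits (sym size)))) (m*n%n≡0 s 3)

    N%3≡0⇒diagonal-Fits : N % 3 ≡ 0 → ∃ λ s → Fits n (diagonal s)
    N%3≡0⇒diagonal-Fits N%3≡0 with m%n≡0⇒n∣m N 3 N%3≡0
    ... | divides s N≡s*3 = s , trans (cong (7 +_) (trans (sum₃-diagonal s) (sym N≡s*3))) size

    representatives : Vec (Sub n) (length (canonical N))
    representatives = targets n (canonical N)

    canonical-Fits : ∀ {c} → c ∈ canonical N → Fits n c
    canonical-Fits c∈ = trans (cong (7 +_) (proj₂ (canonical-sound N c∈))) size

    rep : Fin (length (canonical N)) → Triple
    rep = List.lookup (canonical N)

    rep-Fits : ∀ i → Fits n (rep i)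
    rep-Fits i = canonical-Fits (∈-lookup i)

    rep-canonical : ∀ i → IsCanonical (rep i)
    rep-canonical i = proj₁ (canonical-sound N (∈-lookup i))

  canonical-DistinctOrbits : DistinctOrbits representatives
  canonical-DistinctOrbits = ics , distinct
    where
    ics : ∀ i → IsICS (lookup representatives i)
    ics i = subst (IsICS {n}) (sym (lookup-targets (canonical N) i)) (target-isICS {n} (rep i))
    distinct : ∀ i j → i ≢ j → ¬ InOrbit (lookup representatives i) (lookup representatives j)
    distinct i j i≢j orbit = i≢j (Unique⇒lookup-injective (canonical-unique N) (sym
      (canonical-rotation-unique (rep-canonical i) (rep-canonical j)
        (InOrbit-target⇒∈-rotations (rep i) (rep j) (rep-Fits i) (rep-Fits j)
          (subst₂ InOrbit (lookup-targets (canonical N) i) (lookup-targets (canonical N) j) orbit)))))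

  canonical-OrbitSize : ∀ i → OrbitSize (lookup representatives i) (n + 5)
  canonical-OrbitSize i = subst (λ I → OrbitSize I (n + 5)) (sym (lookup-targets (canonical N) i))
    (target-OrbitSize (rep i) (rep-Fits i) (canonical-non-fixed (rep-canonical i)))

  canonical-covers : ∀ t → Fits n t →
    (∃ λ s → t ≡ diagonal s) ⊎ (Σ (Fin (length (canonical N))) λ i → InOrbit (lookup representatives i) (target n t))
  canonical-covers t fits with canonical-representative t
  ... | inj₁ diagonal-t = inj₁ diagonal-t
  ... | inj₂ (c , canonical-c , t∈) = inj₂ (i , subst (λ I → InOrbit I (target n t)) (sym (lookup-targets (canonical N) i))
          (subst (λ c → InOrbit (target n c) (target n t)) (lookup-index c∈) (∈-rotations⇒InOrbit-target c t c-Fits t∈)))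
    where
    c-Fits : Fits n c
    c-Fits = trans (cong (7 +_) (sym (sum₃-∈-rotations t∈))) fits
    c∈ : c ∈ canonical N
    c∈ = subst (λ M → c ∈ canonical M) (+-cancelˡ-≡ 7 _ _ (trans c-Fits (sym size))) (∈-canonical c canonical-c)
    i : Fin (length (canonical N))
    i = index c∈

  canonical↛diagonal : ∀ {s} → Fits n (diagonal s) → ∀ i → ¬ InOrbit (lookup representatives i) (target n (diagonal s))
  canonical↛diagonal {s} fits i orbit = canonical-non-diagonal s (rep-canonical i) (diagonal-∈-rotations s
    (InOrbit-target⇒∈-rotations (rep i) (diagonal s) (rep-Fits i) fits (subst (λ I → InOrbit I _) (lookup-targets (canonical N) i) orbit)))

  diagonal↛canonical : ∀ {s} → Fits n (diagonal s) → ∀ i → ¬ InOrbit (target n (diagonal s)) (lookup representatives i)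
  diagonal↛canonical {s} fits i orbit = canonical-non-diagonal s (rep-canonical i) (∈-rotations-diagonal s
    (InOrbit-target⇒∈-rotations (diagonal s) (rep i) fits (rep-Fits i) (subst (InOrbit _) (lookup-targets (canonical N) i) orbit)))

  orbits-without-diagonal : (n % 3 ≡ 0 ⊎ n % 3 ≡ 2) →
    Σ ℕ λ m → Σ (Vec (Sub n) m) λ reps →
      (3 * m ≡ (n ∸ 5) C 2) × DistinctOrbits reps × (∀ r → OrbitSize (lookup reps r) (n + 5)) × CoversTargets reps
  orbits-without-diagonal n%3≢1 =
    length (canonical N) , representatives ,
    trans (3*length-canonical N N%3≢0) (cong (λ m → (m ∸ 5) C 2) size) , canonical-DistinctOrbits , canonical-OrbitSize ,
    CoversTargets-intro representatives covers
    where
    N%3≢0 : N % 3 ≢ 0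
    N%3≢0 N%3≡0 = excluded n%3≢1
      where
      n%3≡1 : n % 3 ≡ 1
      n%3≡1 = Equivalence.from n%3≡1⇔N%3≡0 N%3≡0
      excluded : ¬ (n % 3 ≡ 0 ⊎ n % 3 ≡ 2)
      excluded (inj₁ n%3≡0) = contradiction (trans (sym n%3≡1) n%3≡0) λ ()
      excluded (inj₂ n%3≡2) = contradiction (trans (sym n%3≡1) n%3≡2) λ ()
    covers : ∀ t → Fits n t → Σ (Fin (length (canonical N))) λ i → InOrbit (lookup representatives i) (target n t)
    covers t fits with canonical-covers t fits
    ... | inj₁ (s , refl) = contradiction (diagonal-Fits⇒N%3≡0 {s} fits) N%3≢0
    ... | inj₂ covered = covered

  orbits-with-diagonal : n % 3 ≡ 1 →
    Σ ℕ λ m → Σ (Sub n) λ I₀ → Σ (Vec (Sub n) m) λ reps →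
      (6 * m ≡ (n ∸ 4) * (n ∸ 7)) × DistinctOrbits (I₀ ∷ reps) × (Σ ℕ λ s → (3 * s ≡ n + 5) × OrbitSize I₀ s) ×
      (∀ r → OrbitSize (lookup reps r) (n + 5)) × CoversTargets (I₀ ∷ reps)
  orbits-with-diagonal n%3≡1 with N%3≡0⇒diagonal-Fits (Equivalence.to n%3≡1⇔N%3≡0 n%3≡1)
  ... | s , fits =
    length (canonical N) , target n (diagonal s) , representatives ,
    trans (6*length-canonical N (Equivalence.to n%3≡1⇔N%3≡0 n%3≡1)) (cong (λ m → (m ∸ 4) * (m ∸ 7)) size) ,
    DistinctOrbits-∷ (target-isICS {n} (diagonal s)) (diagonal↛canonical fits) (canonical↛diagonal fits) canonical-DistinctOrbits ,
    (4 + s , trans (solve 1 (λ s → con 3 :* (con 4 :+ s) := con 7 :+ (s :+ s :+ s) :+ con 5) refl s) (cong (_+ 5) fits) ,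
     diagonal-OrbitSize s fits) ,
    canonical-OrbitSize ,
    CoversTargets-intro (target n (diagonal s) ∷ representatives) covers
    where
    covers : ∀ t → Fits n t → Σ (Fin (suc (length (canonical N)))) λ i → InOrbit (lookup (target n (diagonal s) ∷ representatives) i) (target n t)
    covers t fits′ with canonical-covers t fits′
    ... | inj₁ (s′ , refl) = fzero , 0 , cong (target n ∘ diagonal) (diagonal-Fits-unique fits fits′)
    ... | inj₂ (i , orbit) = fsuc i , orbit

theorem3p18 : (n : ℕ) → 7 ≤ n →
    ((n % 3 ≡ 0 ⊎ n % 3 ≡ 2) →
      Σ ℕ λ m → Σ (Vec (Sub n) m) λ reps →
        (3 * m ≡ (n ∸ 5) C 2) ×
        DistinctOrbits reps ×
        (∀ r → OrbitSize (lookup reps r) (n + 5)) ×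
        CoversTargets reps)
    ×
    (n % 3 ≡ 1 →
      Σ ℕ λ m → Σ (Sub n) λ I₀ → Σ (Vec (Sub n) m) λ reps →
        (6 * m ≡ (n ∸ 4) * (n ∸ 7)) ×
        DistinctOrbits (I₀ ∷ reps) ×
        (Σ ℕ λ s → (3 * s ≡ n + 5) × OrbitSize I₀ s) ×
        (∀ r → OrbitSize (lookup reps r) (n + 5)) ×
        CoversTargets (I₀ ∷ reps))
theorem3p18 n 7≤n = orbits-without-diagonal size , orbits-with-diagonal size
  where
  size : 7 + (n ∸ 7) ≡ n
  size = m+[n∸m]≡n 7≤n
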